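{- Let $\sigma$ and $\tau=a_1a_2\cdots a_n$ be permutations such that $\sigma$ has exactly one occurrence in $\tau$ (as a quasi-consecutive pattern), and suppose this occurrence uses position $1$ (the entry $a_1$) but uses neither position $2$ nor position $n$. Then $\mu(\sigma,\tau)=0$, unless the interval $[\sigma,\tau]$ has rank $2$, in which case $\mu(\sigma,\tau)=1$.
   Context: Permutations are written in one-line notation. For permutations $\sigma$ of length $m$ and $\tau=a_1a_2\cdots a_n$ of length $n$, an occurrence of $\sigma$ in $\tau$ (as a quasi-consecutive pattern) is a sequence of positions $1\le i_1<i_2<\cdots<i_m\le n$ such that $i_{j+1}=i_j+1$ for all $2\le j\le m-1$ and $a_{i_1}\cdots a_{i_m}$ is order-isomorphic to $\sigma$ (i.e. $a_{i_s}<a_{i_t}$ iff $\sigma_s<\sigma_t$); thus all entries of the occurrence are adjacent in $\tau$ except possibly the first and second. The occurrence uses position $p$ if $p\in\{i_1,\dots,i_m\}$. The quasi-consecutive pattern poset is the set of all finite permutations ordered by $\sigma\le\tau$ iff $\tau$ contains an occurrence of $\sigma$. The interval $[\sigma,\tau]$ is $\{\rho:\sigma\le\rho\le\tau\}$, and its rank is $n-m$ (the length of every maximal chain in it). $\mu$ is the Möbius function of this poset: $\mu(x,x)=1$ and $\mu(x,y)=-\sum_{x\le z<y}\mu(x,z)$ for $x<y$. -}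

module Defs where

open import Data.Bool using (Bool; true; false; _∧_; if_then_else_; not)
open import Data.Nat using (ℕ; zero; suc; _+_; _∸_; _<ᵇ_; _≡ᵇ_)
import Data.Nat as N
open import Data.List using (List; []; _∷_; length; map; upTo; concatMap; filterᵇ; _++_; take; drop; applyUpTo)
open import Data.List.Properties using (≡-dec)
open import Data.Bool.ListAction using (all; any)
open import Data.List.Relation.Binary.Permutation.Propositional using (_↭_)
open import Data.Integer using (ℤ; -_) renaming (_+_ to _+ℤ_)
open import Relation.Nullary using (does)

IsPerm : List ℕ → Set
IsPerm xs = xs ↭ map suc (upTo (length xs))

-- 0-based lookup with a default (only used at in-bound positions)
nth : List ℕ → ℕ → ℕ
nth [] _ = 0
nth (x ∷ xs) zero = x
nth (x ∷ xs) (suc i) = nth xs i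

orderIso : List ℕ → List ℕ → Bool
orderIso xs ys =
  (length xs ≡ᵇ length ys) ∧
  all (λ s → all (λ t → eqB (nth xs s <ᵇ nth xs t) (nth ys s <ᵇ nth ys t))
                 (upTo (length xs)))
      (upTo (length xs))
  where
  eqB : Bool → Bool → Bool
  eqB true b = b
  eqB false b = not b

consecFrom : ℕ → List ℕ → Bool
consecFrom i [] = true
consecFrom i (j ∷ js) = (j ≡ᵇ suc i) ∧ consecFrom j js

qcShape : List ℕ → Bool
qcShape [] = true
qcShape (i ∷ []) = true
qcShape (i ∷ j ∷ js) = (i <ᵇ j) ∧ consecFrom j js

-- isOcc σ τ is : the (0-based) position list `is` is an occurrence of σ in τ
-- as a quasi-consecutive pattern.
isOcc : List ℕ → List ℕ → List ℕ → Bool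
isOcc σ τ is =
  (length is ≡ᵇ length σ) ∧ qcShape is ∧ all (_<ᵇ length τ) is ∧
  orderIso σ (map (nth τ) is)

candidates : ℕ → ℕ → List (List ℕ)
candidates zero n = [] ∷ []
candidates (suc zero) n = map (λ i → i ∷ []) (upTo n)
candidates (suc (suc k)) n =
  concatMap (λ i → map (λ j → i ∷ j ∷ applyUpTo (λ r → suc (j + r)) k) (upTo n)) (upTo n)

leqᵇ : List ℕ → List ℕ → Bool
leqᵇ σ τ = any (isOcc σ τ) (candidates (length σ) (length τ))

insertAll : ℕ → List ℕ → List (List ℕ)
insertAll x xs = map (λ p → take p xs ++ (x ∷ drop p xs)) (upTo (suc (length xs)))

perms : ℕ → List (List ℕ)
perms zero = [] ∷ []
perms (suc k) = concatMap (insertAll (suc k)) (perms k)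

-- permutations z with σ ≤ z ≤ τ and length z < length τ (i.e. σ ≤ z < τ)
below : List ℕ → List ℕ → List (List ℕ)
below σ τ = filterᵇ (λ z → leqᵇ σ z ∧ leqᵇ z τ) (concatMap perms (upTo (length τ)))

sumℤ : List ℤ → ℤ
sumℤ [] = ℤ.pos 0
sumℤ (x ∷ xs) = x +ℤ sumℤ xs

_==_ : List ℕ → List ℕ → Bool
xs == ys = does (≡-dec N._≟_ xs ys)

-- Möbius function, by recursion with fuel (fuel = length τ suffices)
μF : ℕ → List ℕ → List ℕ → ℤ
μF zero σ τ = if σ == τ then ℤ.pos 1 else ℤ.pos 0
μF (suc f) σ τ =
  if σ == τ then ℤ.pos 1
  else if leqᵇ σ τ then - sumℤ (map (μF f σ) (below σ τ))
  else ℤ.pos 0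

μ : List ℕ → List ℕ → ℤ
μ σ τ = μF (length τ) σ τ

-- With 0-based positions the occurrence is 0, j, j+1, …, j+k with
-- 1 < j and j+k+1 < n.  For a < j and j+k+b < n let ρ a b be the
-- permutation τ shows on position 0 together with the block j-a, …, j+k+b.
-- Then ρ 0 0 = σ, the widest window gives τ, and ρ a′ b′ ≤ ρ a b when
-- a′ ≤ a and b′ ≤ b.  Conversely (`interval-element`) an occurrence of σ in
-- z read through an occurrence of z in ρ a b is an occurrence of σ in τ,
-- hence the given one, which forces z = ρ a′ b′ for a smaller window.  So
-- [σ,τ] is a product of two chains of lengths A = j-1 ≥ 1 and B = n-j-k-1 ≥ 1,
-- and μ(σ,τ) = μ(chain A)·μ(chain B), which is 1 for A = B = 1 and 0 else.
module Submission where

open import Defs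
open import Data.Nat using (ℕ; _∸_)
open import Data.List using (List; length)
open import Data.List.Membership.Propositional using (_∈_; _∉_)
open import Data.Bool using (true)
open import Data.Integer using (ℤ)
open import Data.Product using (Σ; _×_)
open import Relation.Binary.PropositionalEquality using (_≡_; _≢_)

open import Data.Bool using (Bool; false; _∧_; T)
open import Data.Bool.ListAction using (all; any)
open import Data.Empty using (⊥; ⊥-elim)
open import Data.Unit using (tt)
open import Data.Product using (_,_; proj₁; proj₂; ∃-syntax)
open import Data.Product.Properties using () renaming (≡-dec to ×-≡-dec)
open import Data.Sum using (_⊎_; inj₁; inj₂)
open import Data.Nat using (zero; suc; _+_; _≤_; _<_; z≤n; s≤s; s≤s⁻¹; z<s; s<s; _≡ᵇ_; _<ᵇ_; _≟_; _⊓_)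
open import Data.Nat.Properties
open import Data.Integer using (-_) renaming (_+_ to _+ℤ_; _*_ to _*ℤ_)
import Data.Integer.Properties as ℤP
open import Data.List
  using ([]; _∷_; map; filter; upTo; applyUpTo; concatMap; filterᵇ; take; drop; _++_; [_]; cartesianProduct)
open import Data.List.Properties
  using (length-map; length-applyUpTo; map-applyUpTo; map-upTo; map-++; map-∘; upTo-∷ʳ; ++-identityʳ; length-++;
         take++drop≡id; ∷-injectiveˡ; ∷-injectiveʳ; filter-all; filter-accept; filter-reject; ≡-dec)
open import Data.List.Membership.Propositional using (find; lose)
open import Data.List.Membership.Propositional.Properties
  using (∈-filter⁻; ∈-filter⁺; ∈-map⁺; ∈-map⁻; ∈-upTo⁺; ∈-upTo⁻; ∈-applyUpTo⁺; ∈-applyUpTo⁻;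
         ∈-∃++; ∈-cartesianProduct⁺; ∈-cartesianProduct⁻; ∈-concatMap⁺; ∈-concatMap⁻)
open import Data.List.Membership.Propositional.Properties.WithK using (unique∧set⇒bag)
open import Data.List.Relation.Unary.Any using (here; there)
open import Data.List.Relation.Unary.Any.Properties using (any⁺; any⁻)
open import Data.List.Relation.Unary.All as All using (All; []; _∷_)
import Data.List.Relation.Unary.All.Properties as AllP
open AllP using (all⁺; all⁻)
open import Data.List.Relation.Unary.AllPairs as AllPairs using (AllPairs; []; _∷_)
import Data.List.Relation.Unary.AllPairs.Properties as AllPairsP
open import Data.List.Relation.Unary.Unique.Propositional using (Unique)
import Data.List.Relation.Unary.Unique.Propositional.Properties as UniqueP
open import Data.List.Relation.Unary.Sorted.TotalOrder.Properties using (Sorted⇒AllPairs)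
open import Data.List.Relation.Binary.Permutation.Propositional using (_↭_; ↭-sym; ↭-trans; ↭-reflexive)
import Data.List.Relation.Binary.Permutation.Propositional as ↭
open import Data.List.Relation.Binary.Permutation.Propositional.Properties
  using (∈-resp-↭; All-resp-↭; ↭-length; shift; drop-mid; ∷↭∷ʳ)
import Data.List.Relation.Binary.Permutation.Propositional.Properties as ↭P
open import Data.List.Relation.Binary.BagAndSetEquality using (∼bag⇒↭)
open import Data.List.Sort ≤-decTotalOrder using (sort; sort-↭; sort-↗)
open import Function using (_∘_)
open import Function.Bundles using (mk⇔)
open import Relation.Binary.PropositionalEquality
  using (refl; sym; trans; cong; cong₂; subst; subst₂; module ≡-Reasoning)
open import Relation.Nullary using (Dec; ¬_; ¬?; yes; no)
open import Relation.Nullary.Decidable using (T?; dec-true; dec-false; _×-dec_)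

-- Boolean reflection.  The tests of Defs compute Booleans and hand us facts
-- as `b ≡ true`; the library reflects tests through `T b`.
T⇒≡ : ∀ {b} → T b → b ≡ true
T⇒≡ {true} _ = refl

≡⇒T : ∀ {b} → b ≡ true → T b
≡⇒T refl = tt

∧-elim : ∀ {a b} → a ∧ b ≡ true → a ≡ true × b ≡ true
∧-elim {true} {true} _ = refl , refl

∧-intro : ∀ {a b} → a ≡ true → b ≡ true → a ∧ b ≡ true
∧-intro refl refl = refl

≡ᵇ-sound : ∀ {m n} → (m ≡ᵇ n) ≡ true → m ≡ n
≡ᵇ-sound {m} {n} e = ≡ᵇ⇒≡ m n (≡⇒T e)

≡ᵇ-complete : ∀ {m n} → m ≡ n → (m ≡ᵇ n) ≡ true
≡ᵇ-complete {m} {n} e = T⇒≡ (≡⇒≡ᵇ m n e)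

<ᵇ-sound : ∀ {m n} → (m <ᵇ n) ≡ true → m < n
<ᵇ-sound {m} {n} e = <ᵇ⇒< m n (≡⇒T e)

<ᵇ-complete : ∀ {m n} → m < n → (m <ᵇ n) ≡ true
<ᵇ-complete m<n = T⇒≡ (<⇒<ᵇ m<n)

<ᵇ-refute : ∀ {m n} → (m <ᵇ n) ≡ false → n ≤ m
<ᵇ-refute e = ≮⇒≥ (λ m<n → subst T e (<⇒<ᵇ m<n))

≥⇒<ᵇ-false : ∀ {m n} → n ≤ m → (m <ᵇ n) ≡ false
≥⇒<ᵇ-false {m} {n} n≤m with m <ᵇ n in e
... | false = refl
... | true = ⊥-elim (≤⇒≯ n≤m (<ᵇ-sound e))

all-sound : ∀ {A : Set} (p : A → Bool) xs → all p xs ≡ true → ∀ {x} → x ∈ xs → p x ≡ true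
all-sound p xs e x∈ = T⇒≡ (All.lookup (all⁺ p xs (≡⇒T e)) x∈)

all-complete : ∀ {A : Set} (p : A → Bool) xs → (∀ {x} → x ∈ xs → p x ≡ true) → all p xs ≡ true
all-complete p xs h = T⇒≡ (all⁻ p (All.tabulate (λ x∈ → ≡⇒T (h x∈))))

all-refute : ∀ {A : Set} (p : A → Bool) xs → all p xs ≡ false → ∃[ x ] x ∈ xs × p x ≡ false
all-refute p (y ∷ ys) e with p y in py
... | false = y , here refl , py
... | true = let x , x∈ , px = all-refute p ys e in x , there x∈ , px

any-sound : ∀ {A : Set} (p : A → Bool) xs → any p xs ≡ true → ∃[ x ] x ∈ xs × p x ≡ true
any-sound p xs e = let x , x∈ , px = find (any⁻ p xs (≡⇒T e)) in x , x∈ , T⇒≡ px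

any-complete : ∀ {A : Set} (p : A → Bool) xs {x} → x ∈ xs → p x ≡ true → any p xs ≡ true
any-complete p xs x∈ px = T⇒≡ (any⁺ p (lose x∈ (≡⇒T px)))

∈-filterᵇ⁻ : ∀ {A : Set} (p : A → Bool) xs {x} → x ∈ filterᵇ p xs → x ∈ xs × p x ≡ true
∈-filterᵇ⁻ p xs x∈ = let x∈xs , px = ∈-filter⁻ (T? ∘ p) x∈ in x∈xs , T⇒≡ px

∈-filterᵇ⁺ : ∀ {A : Set} (p : A → Bool) xs {x} → x ∈ xs → p x ≡ true → x ∈ filterᵇ p xs
∈-filterᵇ⁺ p xs x∈ px = ∈-filter⁺ (T? ∘ p) x∈ (≡⇒T px)


nth-map : ∀ (f : ℕ → ℕ) Q {s} → s < length Q → nth (map f Q) s ≡ f (nth Q s)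
nth-map f (q ∷ Q) {zero} _ = refl
nth-map f (q ∷ Q) {suc s} (s≤s s<) = nth-map f Q s<

nth-∈ : ∀ Q {s} → s < length Q → nth Q s ∈ Q
nth-∈ (q ∷ Q) {zero} _ = here refl
nth-∈ (q ∷ Q) {suc s} (s≤s s<) = there (nth-∈ Q s<)

nth-applyUpTo : ∀ (f : ℕ → ℕ) n {t} → t < n → nth (applyUpTo f n) t ≡ f t
nth-applyUpTo f (suc n) {zero} _ = refl
nth-applyUpTo f (suc n) {suc t} (s≤s t<) = nth-applyUpTo (f ∘ suc) n t<

nth-ext : ∀ X Y → length X ≡ length Y → (∀ s → s < length X → nth X s ≡ nth Y s) → X ≡ Y
nth-ext [] [] _ _ = refl
nth-ext (x ∷ X) (y ∷ Y) l f =
  cong₂ _∷_ (f 0 z<s) (nth-ext X Y (suc-injective l) (λ s s< → f (suc s) (s<s s<)))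

nth-injective : ∀ X → Unique X → ∀ {s t} → s < length X → t < length X → nth X s ≡ nth X t → s ≡ t
nth-injective (x ∷ X) (x∉ ∷ u) {zero} {zero} _ _ _ = refl
nth-injective (x ∷ X) (x∉ ∷ u) {zero} {suc t} _ (s≤s t<) e = ⊥-elim (All.lookup x∉ (nth-∈ X t<) e)
nth-injective (x ∷ X) (x∉ ∷ u) {suc s} {zero} (s≤s s<) _ e = ⊥-elim (All.lookup x∉ (nth-∈ X s<) (sym e))
nth-injective (x ∷ X) (x∉ ∷ u) {suc s} {suc t} (s≤s s<) (s≤s t<) e = cong suc (nth-injective X u s< t< e)

Unique-map : ∀ {A B : Set} (f : A → B) {xs} →
  (∀ {a b} → a ∈ xs → b ∈ xs → f a ≡ f b → a ≡ b) → Unique xs → Unique (map f xs)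
Unique-map f {[]} inj [] = []
Unique-map f {x ∷ xs} inj (x∉ ∷ u) =
  AllP.map⁺ (All.tabulate (λ y∈ e → All.lookup x∉ y∈ (inj (here refl) (there y∈) e)))
  ∷ Unique-map f (λ a∈ b∈ → inj (there a∈) (there b∈)) u

Unique-↭ : ∀ {X Y : List ℕ} → X ↭ Y → Unique X → Unique Y
Unique-↭ ↭.refl u = u
Unique-↭ (↭.prep x p) (x∉ ∷ u) = All-resp-↭ p x∉ ∷ Unique-↭ p u
Unique-↭ (↭.swap x y p) ((x≢y ∷ x∉) ∷ y∉ ∷ u) =
  ((x≢y ∘ sym) ∷ All-resp-↭ p y∉) ∷ All-resp-↭ p x∉ ∷ Unique-↭ p u
Unique-↭ (↭.trans p q) u = Unique-↭ q (Unique-↭ p u)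

map-cong-∈ : ∀ {A B : Set} (f g : A → B) xs → (∀ {x} → x ∈ xs → f x ≡ g x) → map f xs ≡ map g xs
map-cong-∈ f g [] h = refl
map-cong-∈ f g (x ∷ xs) h = cong₂ _∷_ (h (here refl)) (map-cong-∈ f g xs (h ∘ there))


-- Order-isomorphism.  X ≅ Y: X and Y have the same length and compare alike
-- at every pair of positions (the proposition decided by `orderIso`).
_≅_ : List ℕ → List ℕ → Set
X ≅ Y = length X ≡ length Y ×
  (∀ s t → s < length X → t < length X → (nth X s <ᵇ nth X t) ≡ (nth Y s <ᵇ nth Y t))

≅-sym : ∀ {X Y} → X ≅ Y → Y ≅ X
≅-sym (l , f) = sym l , λ s t s< t< → sym (f s t (subst (s <_) (sym l) s<) (subst (t <_) (sym l) t<))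

≅-trans : ∀ {X Y Z} → X ≅ Y → Y ≅ Z → X ≅ Z
≅-trans (l , f) (l′ , g) =
  trans l l′ , λ s t s< t< → trans (f s t s< t<) (g s t (subst (s <_) l s<) (subst (t <_) l t<))

-- The boolean comparison used by `orderIso` is local to Defs and cannot be
-- named, so both directions case on the two compared booleans; the test
-- itself then refutes the mixed cases.
orderIso-sound : ∀ X Y → orderIso X Y ≡ true → X ≅ Y
orderIso-sound X Y e = ≡ᵇ-sound (proj₁ (∧-elim e)) , agree
  where
  agree : ∀ s t → s < length X → t < length X → (nth X s <ᵇ nth X t) ≡ (nth Y s <ᵇ nth Y t)
  agree s t s< t< with all-sound _ _ (all-sound _ _ (proj₂ (∧-elim {length X ≡ᵇ length Y} e)) (∈-upTo⁺ s<)) (∈-upTo⁺ t<)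
  ... | same with nth X s <ᵇ nth X t | nth Y s <ᵇ nth Y t
  ... | true | true = refl
  ... | false | false = refl

-- by refutation: a failing test exhibits two positions whose comparisons differ
orderIso-complete : ∀ X Y → X ≅ Y → orderIso X Y ≡ true
orderIso-complete X Y (l , agree) with orderIso X Y in fails
... | true = refl
... | false rewrite ≡ᵇ-complete l with all-refute _ _ fails
... | s , s∈ , row with all-refute _ _ row
... | t , t∈ , differ with agree s t (∈-upTo⁻ s∈) (∈-upTo⁻ t∈)
... | same with nth X s <ᵇ nth X t | nth Y s <ᵇ nth Y t | differ
... | true | true | ()
... | false | false | ()


-- Restriction.  X at Q is the subsequence of X read at the positions Q; an
-- occurrence of σ in τ at Q says σ ≅ τ at Q.
_at_ : List ℕ → List ℕ → List ℕ
X at Q = map (nth X) Q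

InBounds : ℕ → List ℕ → Set
InBounds n Q = ∀ {q} → q ∈ Q → q < n

length-at : ∀ X Q → length (X at Q) ≡ length Q
length-at X Q = length-map (nth X) Q

≅-at : ∀ {X Y} Q → X ≅ Y → InBounds (length X) Q → (X at Q) ≅ (Y at Q)
≅-at {X} {Y} Q (l , f) inQ = trans (length-at X Q) (sym (length-at Y Q)) , agree
  where
  open ≡-Reasoning
  agree : ∀ s t → s < length (X at Q) → t < length (X at Q) →
          (nth (X at Q) s <ᵇ nth (X at Q) t) ≡ (nth (Y at Q) s <ᵇ nth (Y at Q) t)
  agree s t s< t< = begin
    (nth (X at Q) s <ᵇ nth (X at Q) t)     ≡⟨ cong₂ _<ᵇ_ (nth-map _ Q s<Q) (nth-map _ Q t<Q) ⟩
    (nth X (nth Q s) <ᵇ nth X (nth Q t))   ≡⟨ f _ _ (inQ (nth-∈ Q s<Q)) (inQ (nth-∈ Q t<Q)) ⟩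
    (nth Y (nth Q s) <ᵇ nth Y (nth Q t))   ≡⟨ sym (cong₂ _<ᵇ_ (nth-map _ Q s<Q) (nth-map _ Q t<Q)) ⟩
    (nth (Y at Q) s <ᵇ nth (Y at Q) t)     ∎
    where
    s<Q : s < length Q
    s<Q = subst (s <_) (length-at X Q) s<
    t<Q : t < length Q
    t<Q = subst (t <_) (length-at X Q) t<

at-assoc : ∀ X S Q → InBounds (length S) Q → (X at S) at Q ≡ X at (S at Q)
at-assoc X S [] inQ = refl
at-assoc X S (q ∷ Q) inQ = cong₂ _∷_ (nth-map _ S (inQ (here refl))) (at-assoc X S Q (inQ ∘ there))

InBounds-at : ∀ n S Q → InBounds n S → InBounds (length S) Q → InBounds n (S at Q)
InBounds-at n S (q ∷ Q) inS inQ (here refl) = inS (nth-∈ S (inQ (here refl)))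
InBounds-at n S (q ∷ Q) inS inQ (there m) = InBounds-at n S Q inS (inQ ∘ there) m

≅-compose : ∀ {X Y} S Q → X ≅ (Y at S) → InBounds (length X) Q → (X at Q) ≅ (Y at (S at Q))
≅-compose {X} {Y} S Q iso inQ =
  subst ((X at Q) ≅_) (at-assoc Y S Q inQS) (≅-at {X} {Y at S} Q iso inQ)
  where
  inQS : InBounds (length S) Q
  inQS q∈ = subst (_ <_) (trans (proj₁ iso) (length-at Y S)) (inQ q∈)

at-upTo : ∀ X → X at upTo (length X) ≡ X
at-upTo X = nth-ext _ X l λ s s< →
  let s<n = subst (s <_) l s< in
  trans (nth-map (nth X) (upTo (length X)) (subst (s <_) (sym (length-applyUpTo _ (length X))) s<n))
        (cong (nth X) (nth-applyUpTo (λ r → r) (length X) s<n))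
  where
  l : length (X at upTo (length X)) ≡ length X
  l = trans (length-at X (upTo (length X))) (length-applyUpTo _ (length X))

Unique-at : ∀ X Q → Unique X → Unique Q → InBounds (length X) Q → Unique (X at Q)
Unique-at X Q X! Q! inQ = Unique-map (nth X) (λ p∈ q∈ e → nth-injective X X! (inQ p∈) (inQ q∈) e) Q!

applyUpTo-cong : ∀ (f g : ℕ → ℕ) n → (∀ i → i < n → f i ≡ g i) → applyUpTo f n ≡ applyUpTo g n
applyUpTo-cong f g zero h = refl
applyUpTo-cong f g (suc n) h = cong₂ _∷_ (h 0 z<s) (applyUpTo-cong (f ∘ suc) (g ∘ suc) n (λ i i< → h (suc i) (s<s i<)))


-- Standardisation: the permutation with the order type of a list.

indicator : Bool → ℕ
indicator true = 1
indicator false = 0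

rank : ℕ → List ℕ → ℕ
rank x [] = 0
rank x (y ∷ ys) = indicator (y <ᵇ x) + rank x ys

-- std X replaces every entry by one plus its rank; for a duplicate-free X
-- this is the unique permutation order-isomorphic to X
std : List ℕ → List ℕ
std X = map (λ x → suc (rank x X)) X

length-std : ∀ X → length (std X) ≡ length X
length-std X = length-map _ X

indicator-mono : ∀ {y a b} → a ≤ b → indicator (y <ᵇ a) ≤ indicator (y <ᵇ b)
indicator-mono {y} {a} {b} a≤b with y <ᵇ a in y<a | y <ᵇ b in y<b
... | false | _ = z≤n
... | true | true = ≤-refl
... | true | false = ⊥-elim (<⇒≱ (<-≤-trans (<ᵇ-sound y<a) a≤b) (<ᵇ-refute y<b))

rank-mono : ∀ {a b} X → a ≤ b → rank a X ≤ rank b X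
rank-mono [] _ = z≤n
rank-mono (y ∷ ys) a≤b = +-mono-≤ (indicator-mono {y} a≤b) (rank-mono ys a≤b)

rank-strict : ∀ {a b} X → a < b → a ∈ X → rank a X < rank b X
rank-strict {a} (y ∷ ys) a<b (here refl)
  rewrite <ᵇ-complete a<b | ≥⇒<ᵇ-false (≤-refl {a}) = s≤s (rank-mono ys (<⇒≤ a<b))
rank-strict (y ∷ ys) a<b (there a∈) = +-mono-≤-< (indicator-mono {y} (<⇒≤ a<b)) (rank-strict ys a<b a∈)

rank-<ᵇ : ∀ X a b → a ∈ X → (rank a X <ᵇ rank b X) ≡ (a <ᵇ b)
rank-<ᵇ X a b a∈ with a <ᵇ b in a<b
... | true = <ᵇ-complete (rank-strict X (<ᵇ-sound a<b) a∈)
... | false = ≥⇒<ᵇ-false (rank-mono X (<ᵇ-refute a<b))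

std-≅ : ∀ X → std X ≅ X
std-≅ X = length-std X , λ s t s< t< →
  let s<X = subst (s <_) (length-std X) s< ; t<X = subst (t <_) (length-std X) t< in
  trans (cong₂ _<ᵇ_ (nth-map _ X s<X) (nth-map _ X t<X)) (rank-<ᵇ X _ _ (nth-∈ X s<X))

countBelow : (ℕ → Bool) → ℕ → ℕ
countBelow f zero = 0
countBelow f (suc n) = indicator (f 0) + countBelow (f ∘ suc) n

rank-by-position : ∀ x X → rank x X ≡ countBelow (λ t → nth X t <ᵇ x) (length X)
rank-by-position x [] = refl
rank-by-position x (y ∷ ys) = cong (indicator (y <ᵇ x) +_) (rank-by-position x ys)

countBelow-cong : ∀ f g n → (∀ t → t < n → f t ≡ g t) → countBelow f n ≡ countBelow g n
countBelow-cong f g zero h = refl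
countBelow-cong f g (suc n) h =
  cong₂ _+_ (cong indicator (h 0 z<s)) (countBelow-cong (f ∘ suc) (g ∘ suc) n (λ t t< → h (suc t) (s<s t<)))

≅⇒std≡ : ∀ {X Y} → X ≅ Y → std X ≡ std Y
≅⇒std≡ {X} {Y} (l , f) =
  nth-ext (std X) (std Y) (trans (length-std X) (trans l (sym (length-std Y)))) λ s s< →
    let s<X = subst (s <_) (length-std X) s< in
    begin
      nth (std X) s                                                ≡⟨ nth-map _ X s<X ⟩
      suc (rank (nth X s) X)                                       ≡⟨ cong suc (rank-by-position _ X) ⟩
      suc (countBelow (λ t → nth X t <ᵇ nth X s) (length X))
        ≡⟨ cong suc (countBelow-cong _ _ _ (λ t t< → f t s t< s<X)) ⟩
      suc (countBelow (λ t → nth Y t <ᵇ nth Y s) (length X))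
        ≡⟨ cong (λ n → suc (countBelow (λ t → nth Y t <ᵇ nth Y s) n)) l ⟩
      suc (countBelow (λ t → nth Y t <ᵇ nth Y s) (length Y))     ≡⟨ cong suc (sym (rank-by-position _ Y)) ⟩
      suc (rank (nth Y s) Y)                                       ≡⟨ sym (nth-map _ Y (subst (s <_) l s<X)) ⟩
      nth (std Y) s                                                ∎
  where open ≡-Reasoning

rank-↭ : ∀ x {X Y} → X ↭ Y → rank x X ≡ rank x Y
rank-↭ x ↭.refl = refl
rank-↭ x (↭.prep y p) = cong (indicator (y <ᵇ x) +_) (rank-↭ x p)
rank-↭ x (↭.swap y z p) =
  trans (sym (+-assoc (indicator (y <ᵇ x)) (indicator (z <ᵇ x)) _))
    (trans (cong₂ _+_ (+-comm (indicator (y <ᵇ x)) (indicator (z <ᵇ x))) (rank-↭ x p))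
      (+-assoc (indicator (z <ᵇ x)) (indicator (y <ᵇ x)) _))
rank-↭ x (↭.trans p q) = trans (rank-↭ x p) (rank-↭ x q)

rank-of-minimum : ∀ x X → (∀ {y} → y ∈ X → x ≤ y) → rank x X ≡ 0
rank-of-minimum x [] h = refl
rank-of-minimum x (y ∷ ys) h rewrite ≥⇒<ᵇ-false (h (here refl)) = rank-of-minimum x ys (h ∘ there)

rank-interval : ∀ c k n → rank (c + k) (applyUpTo (c +_) n) ≡ k ⊓ n
rank-interval c k zero = sym (⊓-zeroʳ k)
rank-interval c zero (suc n) = rank-of-minimum (c + 0) (applyUpTo (c +_) (suc n)) λ y∈ →
  let i , _ , y≡ = ∈-applyUpTo⁻ (c +_) y∈ in subst (c + 0 ≤_) (sym y≡) (+-monoʳ-≤ c z≤n)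
rank-interval c (suc k) (suc n) rewrite <ᵇ-complete (+-monoʳ-< c (z<s {k})) =
  cong suc (trans (cong₂ rank (+-suc c k) (applyUpTo-cong _ _ n (λ i _ → +-suc c i))) (rank-interval (suc c) k n))

IsPerm⇒std≡ : ∀ p → IsPerm p → std p ≡ p
IsPerm⇒std≡ p p↭ = nth-ext (std p) p (length-std p) λ s s< →
  let s<p = subst (s <_) (length-std p) s<
      k , k∈ , entry≡ = ∈-map⁻ suc (∈-resp-↭ p↭ (nth-∈ p s<p))
      n = length p
  in begin
    nth (std p) s                                   ≡⟨ nth-map _ p s<p ⟩
    suc (rank (nth p s) p)                          ≡⟨ cong suc (rank-↭ _ p↭) ⟩
    suc (rank (nth p s) (map suc (upTo n)))         ≡⟨ cong₂ (λ x L → suc (rank x L)) entry≡ (map-upTo suc n) ⟩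
    suc (rank (1 + k) (applyUpTo (1 +_) n))         ≡⟨ cong suc (rank-interval 1 k n) ⟩
    suc (k ⊓ n)                                     ≡⟨ cong suc (m≤n⇒m⊓n≡m (<⇒≤ (∈-upTo⁻ k∈))) ⟩
    suc k                                           ≡⟨ sym entry≡ ⟩
    nth p s                                         ∎
  where open ≡-Reasoning

strictify : ∀ {Y} → AllPairs _≤_ Y → Unique Y → AllPairs _<_ Y
strictify [] [] = []
strictify (y≤ ∷ ps) (y≢ ∷ qs) = All.zipWith (λ (le , ne) → ≤∧≢⇒< le ne) (y≤ , y≢) ∷ strictify ps qs

std-increasing : ∀ Y → AllPairs _<_ Y → ∀ c →
  map (λ x → suc (c + rank x Y)) Y ≡ applyUpTo (λ i → suc (c + i)) (length Y)
std-increasing [] _ c = refl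
std-increasing (y ∷ Y) (y< ∷ ps) c = cong₂ _∷_ head tail
  where
  open ≡-Reasoning
  head : suc (c + rank y (y ∷ Y)) ≡ suc (c + 0)
  head rewrite ≥⇒<ᵇ-false (≤-refl {y}) = cong (λ r → suc (c + r)) (rank-of-minimum y Y (<⇒≤ ∘ All.lookup y<))
  tail : map (λ x → suc (c + rank x (y ∷ Y))) Y ≡ applyUpTo (λ i → suc (c + suc i)) (length Y)
  tail = begin
    map (λ x → suc (c + rank x (y ∷ Y))) Y
      ≡⟨ map-cong-∈ _ _ Y (λ {x} x∈ →
           cong (λ b → suc (c + (indicator b + rank x Y))) (<ᵇ-complete (All.lookup y< x∈))) ⟩
    map (λ x → suc (c + suc (rank x Y))) Y
      ≡⟨ map-cong-∈ _ _ Y (λ _ → cong suc (+-suc c _)) ⟩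
    map (λ x → suc (suc c + rank x Y)) Y              ≡⟨ std-increasing Y ps (suc c) ⟩
    applyUpTo (λ i → suc (suc c + i)) (length Y)      ≡⟨ applyUpTo-cong _ _ _ (λ i _ → cong suc (sym (+-suc c i))) ⟩
    applyUpTo (λ i → suc (c + suc i)) (length Y)      ∎

-- standardising a duplicate-free list gives a permutation: compare with the
-- sorted rearrangement of X
std-IsPerm : ∀ X → Unique X → IsPerm (std X)
std-IsPerm X X! =
  ↭-trans (↭P.map⁺ _ (↭-sym sorted↭X)) (↭-reflexive (begin
    map (λ x → suc (rank x X)) (sort X)        ≡⟨ map-cong-∈ _ _ (sort X) (λ _ → cong suc (rank-↭ _ (↭-sym sorted↭X))) ⟩
    map (λ x → suc (0 + rank x (sort X))) (sort X) ≡⟨ std-increasing (sort X) increasing 0 ⟩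
    applyUpTo suc (length (sort X))            ≡⟨ cong (applyUpTo suc) (↭-length sorted↭X) ⟩
    applyUpTo suc (length X)                   ≡⟨ sym (map-upTo suc (length X)) ⟩
    map suc (upTo (length X))                  ≡⟨ cong (map suc ∘ upTo) (sym (length-std X)) ⟩
    map suc (upTo (length (std X)))            ∎))
  where
  open ≡-Reasoning
  sorted↭X : sort X ↭ X
  sorted↭X = sort-↭ X
  increasing : AllPairs _<_ (sort X)
  increasing = strictify (Sorted⇒AllPairs ≤-totalOrder (sort-↗ X)) (Unique-↭ (↭-sym sorted↭X) X!)


-- The enumeration `perms` of Defs lists each permutation of a length once.

ins : ℕ → ℕ → List ℕ → List ℕ
ins p x xs = take p xs ++ (x ∷ drop p xs)

ins-↭ : ∀ p x xs → ins p x xs ↭ x ∷ xs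
ins-↭ p x xs = ↭-trans (shift x (take p xs) (drop p xs)) (↭.prep x (↭-reflexive (take++drop≡id p xs)))

upTo-suc-↭ : ∀ k → map suc (upTo (suc k)) ↭ suc k ∷ map suc (upTo k)
upTo-suc-↭ k = ↭-trans (↭-reflexive (trans (cong (map suc) (sym (upTo-∷ʳ k))) (map-++ suc (upTo k) [ k ])))
                       (↭-sym (∷↭∷ʳ (suc k) (map suc (upTo k))))

∈-concatMap-intro : ∀ {A B : Set} (f : A → List B) {x y xs} → x ∈ xs → y ∈ f x → y ∈ concatMap f xs
∈-concatMap-intro f x∈ y∈ = ∈-concatMap⁺ f (lose x∈ y∈)

∈-concatMap-elim : ∀ {A B : Set} (f : A → List B) xs {y} → y ∈ concatMap f xs → ∃[ x ] x ∈ xs × y ∈ f x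
∈-concatMap-elim f xs y∈ = find (∈-concatMap⁻ f y∈)

perms-sound : ∀ k z → z ∈ perms k → IsPerm z × length z ≡ k
perms-sound zero .[] (here refl) = ↭.refl , refl
perms-sound (suc k) z z∈ with ∈-concatMap-elim (insertAll (suc k)) (perms k) z∈
... | w , w∈ , z∈w with ∈-map⁻ (λ p → ins p (suc k) w) {xs = upTo (suc (length w))} z∈w
... | p , _ , refl with perms-sound k w w∈
... | w↭ , refl = z↭ , len
  where
  len : length (ins p (suc k) w) ≡ suc (length w)
  len = ↭-length (ins-↭ p (suc k) w)
  z↭ : IsPerm (ins p (suc k) w)
  z↭ = ↭-trans (ins-↭ p (suc k) w) (↭-trans (↭.prep (suc k) w↭)
         (↭-sym (subst (λ n → map suc (upTo n) ↭ suc k ∷ map suc (upTo k)) (sym len) (upTo-suc-↭ k))))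

ins-at-length : ∀ (A B : List ℕ) x → ins (length A) x (A ++ B) ≡ A ++ x ∷ B
ins-at-length [] B x = refl
ins-at-length (a ∷ A) B x = cong (a ∷_) (ins-at-length A B x)

-- every permutation of length n is enumerated: remove its largest entry n
perms-complete : ∀ n p → length p ≡ n → IsPerm p → p ∈ perms n
perms-complete zero [] _ _ = here refl
perms-complete (suc n) p len p↭
  with ∈-∃++ (∈-resp-↭ (↭-sym p↭) (subst (λ m → suc n ∈ map suc (upTo m)) (sym len)
                                          (∈-resp-↭ (↭-sym (upTo-suc-↭ n)) (here refl))))
... | A , B , refl =
  ∈-concatMap-intro (insertAll (suc n)) (perms-complete n (A ++ B) lenAB AB↭)
    (subst (_∈ insertAll (suc n) (A ++ B)) (ins-at-length A B (suc n))
      (∈-map⁺ _ (∈-upTo⁺ (s≤s (subst (length A ≤_) (sym (length-++ A)) (m≤m+n (length A) (length B)))))))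
  where
  lenAB : length (A ++ B) ≡ n
  lenAB = suc-injective (trans (sym (↭-length (shift (suc n) A B))) len)
  AB↭ : IsPerm (A ++ B)
  AB↭ = subst (λ m → A ++ B ↭ map suc (upTo m)) (sym lenAB)
    (↭-trans (drop-mid A (map suc (upTo n)) (↭-trans (subst (λ m → A ++ suc n ∷ B ↭ map suc (upTo m)) len p↭)
      (↭-reflexive (trans (cong (map suc) (sym (upTo-∷ʳ n))) (map-++ suc (upTo n) [ n ])))))
      (↭-reflexive (++-identityʳ _)))

ins-injective : ∀ p q x xs ys → x ∉ xs → x ∉ ys → p ≤ length xs → q ≤ length ys →
  ins p x xs ≡ ins q x ys → p ≡ q × xs ≡ ys
ins-injective zero zero x xs ys _ _ _ _ refl = refl , refl
ins-injective zero (suc q) x xs (y ∷ ys) _ x∉ _ _ e = ⊥-elim (x∉ (here (∷-injectiveˡ e)))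
ins-injective (suc p) zero x (y ∷ xs) ys x∉ _ _ _ e = ⊥-elim (x∉ (here (sym (∷-injectiveˡ e))))
ins-injective (suc p) (suc q) x (y ∷ xs) (y′ ∷ ys) x∉ x∉′ (s≤s p≤) (s≤s q≤) e
  with ∷-injectiveˡ e | ins-injective p q x xs ys (x∉ ∘ there) (x∉′ ∘ there) p≤ q≤ (∷-injectiveʳ e)
... | refl | refl , refl = refl , refl

perms-bound : ∀ k z → z ∈ perms k → ∀ {y} → y ∈ z → y ≤ k
perms-bound k z z∈ y∈ with perms-sound k z z∈
... | z↭ , len with ∈-map⁻ suc (∈-resp-↭ z↭ y∈)
... | i , i∈ , refl = subst (suc i ≤_) len (∈-upTo⁻ i∈)

AllPairs-map-∈ : ∀ {A : Set} {R S : A → A → Set} {xs} →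
  (∀ {a b} → a ∈ xs → b ∈ xs → R a b → S a b) → AllPairs R xs → AllPairs S xs
AllPairs-map-∈ {xs = []} f [] = []
AllPairs-map-∈ {xs = x ∷ xs} f (Rx ∷ Rxs) =
  All.tabulate (λ y∈ → f (here refl) (there y∈) (All.lookup Rx y∈))
  ∷ AllPairs-map-∈ (λ a∈ b∈ → f (there a∈) (there b∈)) Rxs

-- perms k lists every permutation once: the insertions into one w are
-- distinct, and insertions into distinct w are distinct
Unique-perms : ∀ k → Unique (perms k)
Unique-perms zero = [] ∷ []
Unique-perms (suc k) =
  UniqueP.concat⁺ (AllP.map⁺ (All.tabulate (λ z∈ → Unique-map _ (positions z∈) (UniqueP.upTo⁺ _))))
    (AllPairsP.map⁺ (AllPairs-map-∈ disjoint (Unique-perms k)))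
  where
  fresh : ∀ {z} → z ∈ perms k → suc k ∉ z
  fresh z∈ y∈ = 1+n≰n (perms-bound k _ z∈ y∈)
  positions : ∀ {z} → z ∈ perms k → ∀ {p q} → p ∈ upTo (suc (length z)) → q ∈ upTo (suc (length z)) →
              ins p (suc k) z ≡ ins q (suc k) z → p ≡ q
  positions z∈ p∈ q∈ e =
    proj₁ (ins-injective _ _ _ _ _ (fresh z∈) (fresh z∈) (s≤s⁻¹ (∈-upTo⁻ p∈)) (s≤s⁻¹ (∈-upTo⁻ q∈)) e)
  disjoint : ∀ {z z′} → z ∈ perms k → z′ ∈ perms k → z ≢ z′ →
             ∀ {w} → w ∈ insertAll (suc k) z × w ∈ insertAll (suc k) z′ → ⊥
  disjoint {z} {z′} z∈ z′∈ z≢z′ (w∈ , w∈′)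
    with ∈-map⁻ (λ p → ins p (suc k) z) w∈ | ∈-map⁻ (λ p → ins p (suc k) z′) w∈′
  ... | p , p∈ , refl | q , q∈ , e =
    z≢z′ (proj₂ (ins-injective p q _ z z′ (fresh z∈) (fresh z′∈)
                               (s≤s⁻¹ (∈-upTo⁻ p∈)) (s≤s⁻¹ (∈-upTo⁻ q∈)) e))

Unique-permsBelow : ∀ n → Unique (concatMap perms (upTo n))
Unique-permsBelow n = UniqueP.concat⁺ (AllP.map⁺ (All.tabulate (λ {k} _ → Unique-perms k)))
  (AllPairsP.map⁺ (AllPairs.map (λ {k} {k′} k≢k′ {_} (z∈ , z∈′) →
     k≢k′ (trans (sym (proj₂ (perms-sound k _ z∈))) (proj₂ (perms-sound k′ _ z∈′)))) (UniqueP.upTo⁺ n)))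

Unique-IsPerm : ∀ p → IsPerm p → Unique p
Unique-IsPerm p p↭ = Unique-↭ (↭-sym p↭) (Unique-map suc (λ _ _ → suc-injective) (UniqueP.upTo⁺ (length p)))


-- Quasi-consecutive position lists.

-- qc i j k is the position list i, j, j+1, …, j+k; an occurrence of a
-- pattern of length k+2 uses positions of this shape (with i < j)
qc : ℕ → ℕ → ℕ → List ℕ
qc i j k = i ∷ j ∷ applyUpTo (λ r → suc (j + r)) k

length-qc : ∀ i j k → length (qc i j k) ≡ suc (suc k)
length-qc i j k = cong (suc ∘ suc) (length-applyUpTo _ k)

nth-qc : ∀ i j k t → t ≤ k → nth (qc i j k) (suc t) ≡ j + t
nth-qc i j k zero _ = sym (+-identityʳ j)
nth-qc i j k (suc t) t< = trans (nth-applyUpTo _ k t<) (sym (+-suc j t))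

∈-qc : ∀ {i j k x} → x ∈ qc i j k → x ≡ i ⊎ ∃[ t ] t ≤ k × x ≡ j + t
∈-qc (here x≡i) = inj₁ x≡i
∈-qc {j = j} (there (here x≡j)) = inj₂ (0 , z≤n , trans x≡j (sym (+-identityʳ j)))
∈-qc {j = j} (there (there x∈)) =
  let t , t< , x≡ = ∈-applyUpTo⁻ _ x∈ in inj₂ (suc t , t< , trans x≡ (sym (+-suc j t)))

last-∈-qc : ∀ i j k → j + k ∈ qc i j k
last-∈-qc i j zero = there (here (+-identityʳ j))
last-∈-qc i j (suc k) = there (there (subst (_∈ applyUpTo (λ r → suc (j + r)) (suc k)) (sym (+-suc j k))
                                             (∈-applyUpTo⁺ (λ r → suc (j + r)) (≤-refl {suc k}))))

InBounds-qc : ∀ {n i j k} → i < n → j + k < n → InBounds n (qc i j k)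
InBounds-qc i< jk< x∈ with ∈-qc x∈
... | inj₁ refl = i<
... | inj₂ (t , t≤ , refl) = ≤-<-trans (+-monoʳ-≤ _ t≤) jk<

qc-increasing : ∀ i j k s t → i < j → s < t → t ≤ suc k → nth (qc i j k) s < nth (qc i j k) t
qc-increasing i j k zero (suc t) i<j _ t≤ =
  subst (i <_) (sym (nth-qc i j k t (s≤s⁻¹ t≤))) (≤-trans i<j (m≤m+n j t))
qc-increasing i j k (suc s) (suc t) i<j (s≤s s<t) t≤ =
  subst₂ _<_ (sym (nth-qc i j k s (≤-trans (<⇒≤ s<t) (s≤s⁻¹ t≤)))) (sym (nth-qc i j k t (s≤s⁻¹ t≤)))
    (+-monoʳ-< j s<t)

Unique-qc : ∀ i j k → i < j → Unique (qc i j k)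
Unique-qc i j k i<j = AllPairs.map (λ x<y → <⇒≢ x<y) increasing
  where
  tail-above : ∀ x → x ≤ j → All (x <_) (applyUpTo (λ r → suc (j + r)) k)
  tail-above x x≤j = AllP.applyUpTo⁺₁ _ k (λ {r} _ → s≤s (≤-trans x≤j (m≤m+n j r)))
  increasing : AllPairs _<_ (qc i j k)
  increasing = (i<j ∷ tail-above i (<⇒≤ i<j)) ∷ tail-above j ≤-refl
             ∷ AllPairsP.applyUpTo⁺₁ _ k (λ r<r′ _ → s≤s (+-monoʳ-< j r<r′))

qc-compose : ∀ i j k p q l → q + l ≤ k → qc i j k at qc p (suc q) l ≡ qc (nth (qc i j k) p) (j + q) l
qc-compose i j k p q l q+l≤k =
  cong (nth (qc i j k) p ∷_) (cong₂ _∷_ (nth-qc i j k q (≤-trans (m≤m+n q l) q+l≤k))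
    (trans (map-applyUpTo _ (nth (qc i j k)) l) (applyUpTo-cong _ _ l (λ r r<l →
      trans (nth-qc i j k (suc (q + r)) (inside r<l))
        (trans (+-suc j (q + r)) (cong suc (sym (+-assoc j q r))))))))
  where
  inside : ∀ {r} → r < l → suc (q + r) ≤ k
  inside {r} r<l = ≤-trans (≤-reflexive (sym (+-suc q r))) (≤-trans (+-monoʳ-≤ q r<l) q+l≤k)


consecFrom-sound : ∀ j js k → length js ≡ k → consecFrom j js ≡ true → js ≡ applyUpTo (λ r → suc (j + r)) k
consecFrom-sound j [] zero _ _ = refl
consecFrom-sound j (x ∷ xs) (suc k) len e with ∧-elim e
... | x≡ , rest with ≡ᵇ-sound {x} x≡
... | refl = cong₂ _∷_ (cong suc (sym (+-identityʳ j)))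
  (trans (consecFrom-sound (suc j) xs k (suc-injective len) rest) (applyUpTo-cong _ _ k (λ r _ → cong suc (sym (+-suc j r)))))

consecFrom-complete : ∀ j k → consecFrom j (applyUpTo (λ r → suc (j + r)) k) ≡ true
consecFrom-complete j zero = refl
consecFrom-complete j (suc k) rewrite +-identityʳ j =
  ∧-intro (≡ᵇ-complete {suc j} refl)
    (subst (λ L → consecFrom (suc j) L ≡ true) (applyUpTo-cong _ _ k (λ r _ → cong suc (sym (+-suc j r))))
      (consecFrom-complete (suc j) k))

record Occurrence (σ τ P : List ℕ) : Set where
  field
    i t : ℕ
    shape : P ≡ qc i (suc t) (length σ ∸ 2)
    i≤t : i ≤ t
    inBounds : InBounds (length τ) P
    iso : σ ≅ (τ at P)

isOcc-basic : ∀ σ τ P → isOcc σ τ P ≡ true → length P ≡ length σ × InBounds (length τ) P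
isOcc-basic σ τ P found =
  let lenOK , rest = ∧-elim {length P ≡ᵇ length σ} found
      _ , rest = ∧-elim {qcShape P} rest
      boundsOK , _ = ∧-elim {all (_<ᵇ length τ) P} rest
  in ≡ᵇ-sound lenOK , <ᵇ-sound ∘ all-sound (_<ᵇ length τ) P boundsOK

isOcc-sound : ∀ σ τ P → 2 ≤ length σ → isOcc σ τ P ≡ true → Occurrence σ τ P
isOcc-sound σ τ [] 2≤σ e with () ← ≤-trans 2≤σ (≤-reflexive (sym (≡ᵇ-sound {0} (proj₁ (∧-elim e)))))
isOcc-sound σ τ (_ ∷ []) 2≤σ e with s≤s () ← ≤-trans 2≤σ (≤-reflexive (sym (≡ᵇ-sound {1} (proj₁ (∧-elim e)))))
isOcc-sound σ τ (i ∷ zero ∷ js) 2≤σ e with () ← proj₂ (∧-elim {length (i ∷ zero ∷ js) ≡ᵇ length σ} e)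
isOcc-sound σ τ P@(i ∷ suc t ∷ js) 2≤σ e =
  let lenOK , rest = ∧-elim e ; shapeOK , rest = ∧-elim rest ; boundsOK , isoOK = ∧-elim rest
      i<t+1 , consecutive = ∧-elim shapeOK
      len : suc (suc (length js)) ≡ length σ
      len = ≡ᵇ-sound lenOK
  in record
    { i = i ; t = t
    ; shape = cong (λ L → i ∷ suc t ∷ L) (consecFrom-sound (suc t) js (length σ ∸ 2) (cong (_∸ 2) len) consecutive)
    ; i≤t = s≤s⁻¹ (<ᵇ-sound i<t+1)
    ; inBounds = <ᵇ-sound ∘ all-sound (_<ᵇ length τ) P boundsOK
    ; iso = orderIso-sound σ _ isoOK }

Occurrence-host : ∀ {σ τ P} → Occurrence σ τ P → 2 ≤ length τ
Occurrence-host occ = ≤-trans (s≤s (s≤s z≤n)) (inBounds (subst (suc t ∈_) (sym shape) (there (here refl))))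
  where open Occurrence occ

isOcc-complete : ∀ σ τ i j k → length σ ≡ suc (suc k) → i < j → InBounds (length τ) (qc i j k) →
  σ ≅ (τ at qc i j k) → isOcc σ τ (qc i j k) ≡ true
isOcc-complete σ τ i j k len i<j inB iso =
  ∧-intro (≡ᵇ-complete (trans (length-qc i j k) (sym len)))
    (∧-intro (∧-intro (<ᵇ-complete i<j) (consecFrom-complete j k))
      (∧-intro (all-complete _ (qc i j k) (<ᵇ-complete ∘ inB)) (orderIso-complete σ _ iso)))

leqᵇ-sound : ∀ σ τ → leqᵇ σ τ ≡ true → ∃[ P ] isOcc σ τ P ≡ true
leqᵇ-sound σ τ e = let P , _ , occ = any-sound (isOcc σ τ) (candidates (length σ) (length τ)) e in P , occ

leqᵇ-complete : ∀ σ τ i j k → length σ ≡ suc (suc k) → i < j → InBounds (length τ) (qc i j k) →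
  σ ≅ (τ at qc i j k) → leqᵇ σ τ ≡ true
leqᵇ-complete σ τ i j k len i<j inB iso =
  any-complete _ _ (subst (λ m → qc i j k ∈ candidates m (length τ)) (sym len) candidate)
    (isOcc-complete σ τ i j k len i<j inB iso)
  where
  candidate : qc i j k ∈ candidates (suc (suc k)) (length τ)
  candidate = ∈-concatMap-intro _ (∈-upTo⁺ (inB (here refl))) (∈-map⁺ _ (∈-upTo⁺ (inB (there (here refl)))))


sum-↭ : ∀ {L M : List ℤ} → L ↭ M → sumℤ L ≡ sumℤ M
sum-↭ ↭.refl = refl
sum-↭ (↭.prep x p) = cong (x +ℤ_) (sum-↭ p)
sum-↭ (↭.swap {xs} {ys} x y p) =
  trans (sym (ℤP.+-assoc x y (sumℤ xs)))
    (trans (cong₂ _+ℤ_ (ℤP.+-comm x y) (sum-↭ p)) (ℤP.+-assoc y x (sumℤ ys)))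
sum-↭ (↭.trans p q) = trans (sum-↭ p) (sum-↭ q)

sum-sameMembers : ∀ {A : Set} (f : A → ℤ) L M → Unique L → Unique M →
  (∀ {x} → x ∈ L → x ∈ M) → (∀ {x} → x ∈ M → x ∈ L) → sumℤ (map f L) ≡ sumℤ (map f M)
sum-sameMembers f L M L! M! L⊆M M⊆L = sum-↭ (↭P.map⁺ f (∼bag⇒↭ (unique∧set⇒bag L! M! (mk⇔ L⊆M M⊆L))))

sum-++ : ∀ (L M : List ℤ) → sumℤ (L ++ M) ≡ sumℤ L +ℤ sumℤ M
sum-++ [] M = sym (ℤP.+-identityˡ _)
sum-++ (x ∷ L) M = trans (cong (x +ℤ_) (sum-++ L M)) (sym (ℤP.+-assoc x (sumℤ L) (sumℤ M)))

sum-*ˡ : ∀ c (L : List ℤ) → sumℤ (map (c *ℤ_) L) ≡ c *ℤ sumℤ L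
sum-*ˡ c [] = sym (ℤP.*-zeroʳ c)
sum-*ˡ c (x ∷ L) = trans (cong (c *ℤ x +ℤ_) (sum-*ˡ c L)) (sym (ℤP.*-distribˡ-+ c x (sumℤ L)))

sum-cartesianProduct : ∀ (f g : ℕ → ℤ) xs ys →
  sumℤ (map (λ (x , y) → f x *ℤ g y) (cartesianProduct xs ys)) ≡ sumℤ (map f xs) *ℤ sumℤ (map g ys)
sum-cartesianProduct f g [] ys = refl
sum-cartesianProduct f g (x ∷ xs) ys = begin
  sumℤ (map h (map (x ,_) ys ++ cartesianProduct xs ys))
    ≡⟨ cong sumℤ (map-++ h (map (x ,_) ys) _) ⟩
  sumℤ (map h (map (x ,_) ys) ++ map h (cartesianProduct xs ys))
    ≡⟨ sum-++ (map h (map (x ,_) ys)) _ ⟩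
  sumℤ (map h (map (x ,_) ys)) +ℤ sumℤ (map h (cartesianProduct xs ys))
    ≡⟨ cong₂ _+ℤ_ row (sum-cartesianProduct f g xs ys) ⟩
  f x *ℤ sumℤ (map g ys) +ℤ sumℤ (map f xs) *ℤ sumℤ (map g ys)
    ≡⟨ sym (ℤP.*-distribʳ-+ (sumℤ (map g ys)) (f x) _) ⟩
  (f x +ℤ sumℤ (map f xs)) *ℤ sumℤ (map g ys) ∎
  where
  open ≡-Reasoning
  h : ℕ × ℕ → ℤ
  h (x , y) = f x *ℤ g y
  row : sumℤ (map h (map (x ,_) ys)) ≡ f x *ℤ sumℤ (map g ys)
  row = trans (cong sumℤ (trans (sym (map-∘ ys)) (map-∘ ys))) (sum-*ˡ (f x) (map g ys))

other-than : (x y : ℕ × ℕ) → Dec (y ≢ x)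
other-than x y = ¬? (×-≡-dec _≟_ _≟_ y x)

_without_ : List (ℕ × ℕ) → ℕ × ℕ → List (ℕ × ℕ)
L without x = filter (other-than x) L

sum-without : ∀ (g : ℕ × ℕ → ℤ) x L → Unique L → x ∈ L → sumℤ (map g L) ≡ g x +ℤ sumℤ (map g (L without x))
sum-without g x (x ∷ L) (x∉ ∷ _) (here refl) = cong (λ M → g x +ℤ sumℤ (map g M)) (sym (begin
  (x ∷ L) without x   ≡⟨ filter-reject (other-than x) (λ x≢x → x≢x refl) ⟩
  L without x         ≡⟨ filter-all (other-than x) (All.map (λ x≢y → x≢y ∘ sym) x∉) ⟩
  L                   ∎))
  where open ≡-Reasoning
sum-without g x (y ∷ L) (y∉ ∷ L!) (there x∈) = begin
  g y +ℤ sumℤ (map g L)                               ≡⟨ cong (g y +ℤ_) (sum-without g x L L! x∈) ⟩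
  g y +ℤ (g x +ℤ sumℤ (map g (L without x)))          ≡⟨ sym (ℤP.+-assoc (g y) (g x) _) ⟩
  g y +ℤ g x +ℤ sumℤ (map g (L without x))            ≡⟨ cong (_+ℤ sumℤ (map g (L without x))) (ℤP.+-comm (g y) (g x)) ⟩
  g x +ℤ g y +ℤ sumℤ (map g (L without x))            ≡⟨ ℤP.+-assoc (g x) (g y) _ ⟩
  g x +ℤ sumℤ (map g (y ∷ (L without x)))
    ≡⟨ cong (λ M → g x +ℤ sumℤ (map g M)) (sym (filter-accept (other-than x) (All.lookup y∉ x∈))) ⟩
  g x +ℤ sumℤ (map g ((y ∷ L) without x))             ∎
  where open ≡-Reasoning


-- The Möbius function of a product of two chains.

-- Möbius function of the chain 0 < 1 < 2 < ⋯ from 0 to a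
chainμ : ℕ → ℤ
chainμ zero = ℤ.pos 1
chainμ (suc zero) = - ℤ.pos 1
chainμ (suc (suc _)) = ℤ.pos 0

δ₀ : ℕ → ℤ
δ₀ zero = ℤ.pos 1
δ₀ (suc _) = ℤ.pos 0

sum-chainμ : ∀ a → sumℤ (map chainμ (upTo (suc a))) ≡ δ₀ a
sum-chainμ zero = refl
sum-chainμ (suc a) = cong (λ s → ℤ.pos 1 +ℤ (- ℤ.pos 1 +ℤ s)) (trans (cong sumℤ (map-applyUpTo _ chainμ a)) (zeros a))
  where
  zeros : ∀ n → sumℤ (applyUpTo (λ _ → ℤ.pos 0) n) ≡ ℤ.pos 0
  zeros zero = refl
  zeros (suc n) = trans (ℤP.+-identityˡ _) (zeros n)

-- the box [0,a] × [0,b] of the product of two chains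
box : ℕ → ℕ → List (ℕ × ℕ)
box a b = cartesianProduct (upTo (suc a)) (upTo (suc b))

Unique-box : ∀ a b → Unique (box a b)
Unique-box a b = UniqueP.cartesianProduct⁺ (UniqueP.upTo⁺ (suc a)) (UniqueP.upTo⁺ (suc b))

box-without⁻ : ∀ a b {a′ b′} → (a′ , b′) ∈ box a b without (a , b) → a′ ≤ a × b′ ≤ b × (a′ , b′) ≢ (a , b)
box-without⁻ a b p∈ =
  let p∈box , p≢ = ∈-filter⁻ (other-than (a , b)) p∈
      a′∈ , b′∈ = ∈-cartesianProduct⁻ (upTo (suc a)) (upTo (suc b)) p∈box
  in s≤s⁻¹ (∈-upTo⁻ a′∈) , s≤s⁻¹ (∈-upTo⁻ b′∈) , p≢

box-without⁺ : ∀ a b {a′ b′} → a′ ≤ a → b′ ≤ b → (a′ , b′) ≢ (a , b) →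
  (a′ , b′) ∈ box a b without (a , b)
box-without⁺ a b a′≤a b′≤b p≢ =
  ∈-filter⁺ (other-than (a , b))
    (∈-cartesianProduct⁺ (∈-upTo⁺ (s≤s a′≤a)) (∈-upTo⁺ (s≤s b′≤b))) p≢

box-below-sum : ∀ {a b a′ b′} c → a′ ≤ a → b′ ≤ b → (a′ , b′) ≢ (a , b) → a′ + c + b′ < a + c + b
box-below-sum {a} {b} {a′} {b′} c a′≤a b′≤b p≢ with m≤n⇒m<n∨m≡n a′≤a | m≤n⇒m<n∨m≡n b′≤b
... | inj₁ a′<a | _ = +-mono-<-≤ (+-monoˡ-< c a′<a) b′≤b
... | inj₂ refl | inj₁ b′<b = +-monoʳ-< (a′ + c) b′<b
... | inj₂ refl | inj₂ refl = ⊥-elim (p≢ refl)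

-- the Möbius function of the product of two chains is the product of theirs
productμ : ℕ × ℕ → ℤ
productμ (a , b) = chainμ a *ℤ chainμ b

productμ-recursion : ∀ a b → ¬ (a ≡ 0 × b ≡ 0) → - sumℤ (map productμ (box a b without (a , b))) ≡ productμ (a , b)
productμ-recursion a b not-bottom = neg-unique (begin
  productμ (a , b) +ℤ sumℤ (map productμ (box a b without (a , b)))
    ≡⟨ sym (sum-without productμ (a , b) (box a b) (Unique-box a b)
                        (∈-cartesianProduct⁺ (∈-upTo⁺ ≤-refl) (∈-upTo⁺ ≤-refl))) ⟩
  sumℤ (map productμ (box a b))
    ≡⟨ sum-cartesianProduct chainμ chainμ (upTo (suc a)) (upTo (suc b)) ⟩
  sumℤ (map chainμ (upTo (suc a))) *ℤ sumℤ (map chainμ (upTo (suc b)))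
    ≡⟨ cong₂ _*ℤ_ (sum-chainμ a) (sum-chainμ b) ⟩
  δ₀ a *ℤ δ₀ b
    ≡⟨ δ₀δ₀ a b not-bottom ⟩
  ℤ.pos 0 ∎)
  where
  open ≡-Reasoning
  δ₀δ₀ : ∀ a b → ¬ (a ≡ 0 × b ≡ 0) → δ₀ a *ℤ δ₀ b ≡ ℤ.pos 0
  δ₀δ₀ zero zero nb = ⊥-elim (nb (refl , refl))
  δ₀δ₀ zero (suc b) nb = refl
  δ₀δ₀ (suc a) b nb = refl
  neg-unique : ∀ {x S} → x +ℤ S ≡ ℤ.pos 0 → - S ≡ x
  neg-unique {x} {S} e = sym (trans (sym (ℤP.+-identityʳ x)) (trans (cong (x +ℤ_) (sym (ℤP.+-inverseʳ S)))
    (trans (sym (ℤP.+-assoc x S (- S))) (trans (cong (_+ℤ - S) e) (ℤP.+-identityˡ (- S))))))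


-- The recursion defining μ: unfolding, and independence of the fuel.

==-refl : ∀ x → (x == x) ≡ true
==-refl x = dec-true (≡-dec _≟_ x x) refl

==-false : ∀ {x y} → x ≢ y → (x == y) ≡ false
==-false {x} {y} x≢y = dec-false (≡-dec _≟_ x y) x≢y

μF-refl : ∀ f x → μF f x x ≡ ℤ.pos 1
μF-refl zero x rewrite ==-refl x = refl
μF-refl (suc f) x rewrite ==-refl x = refl

μF-unfold : ∀ f σ z → σ ≢ z → leqᵇ σ z ≡ true → μF (suc f) σ z ≡ - sumℤ (map (μF f σ) (below σ z))
μF-unfold f σ z σ≢z σ≤z rewrite ==-false σ≢z | σ≤z = refl

∈-below⁻ : ∀ σ z {x} → x ∈ below σ z →
  IsPerm x × length x < length z × leqᵇ σ x ≡ true × leqᵇ x z ≡ true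
∈-below⁻ σ z x∈ =
  let x∈perms , σ≤x≤z = ∈-filterᵇ⁻ (λ y → leqᵇ σ y ∧ leqᵇ y z) (concatMap perms (upTo (length z))) x∈
      k , k∈ , x∈k = ∈-concatMap-elim perms (upTo (length z)) x∈perms
      x-perm , len = perms-sound k _ x∈k
      σ≤x , x≤z = ∧-elim σ≤x≤z
  in x-perm , subst (_< length z) (sym len) (∈-upTo⁻ k∈) , σ≤x , x≤z

∈-below⁺ : ∀ σ z {x} → IsPerm x → length x < length z → leqᵇ σ x ≡ true → leqᵇ x z ≡ true → x ∈ below σ z
∈-below⁺ σ z x-perm shorter σ≤x x≤z =
  ∈-filterᵇ⁺ _ _ (∈-concatMap-intro perms (∈-upTo⁺ shorter) (perms-complete _ _ refl x-perm)) (∧-intro σ≤x x≤z)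

-- any fuel of at least the length of z computes the same value; without
-- fuel only z = [] is reached, where [σ, []) is empty
μF-fuel : ∀ σ f g z → length z ≤ f → length z ≤ g → μF f σ z ≡ μF g σ z
μF-fuel σ zero zero z _ _ = refl
μF-fuel σ zero (suc g) [] _ _ with σ == [] | leqᵇ σ []
... | true | _ = refl
... | false | true = refl
... | false | false = refl
μF-fuel σ (suc f) zero [] _ _ with σ == [] | leqᵇ σ []
... | true | _ = refl
... | false | true = refl
... | false | false = refl
μF-fuel σ (suc f) (suc g) z z≤f z≤g with σ == z | leqᵇ σ z
... | true | _ = refl
... | false | false = refl
... | false | true = cong (λ s → - sumℤ s) (map-cong-∈ (μF f σ) (μF g σ) (below σ z) λ x∈ →
  let x<z = proj₁ (proj₂ (∈-below⁻ σ z x∈)) in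
  μF-fuel σ f g _ (s≤s⁻¹ (≤-trans x<z z≤f)) (s≤s⁻¹ (≤-trans x<z z≤g)))


-- The interval [σ, τ] is a product of two chains.

module Interval (σ τ : List ℕ) (σ-perm : IsPerm σ) (τ-perm : IsPerm τ) (k j : ℕ)
  (len-σ : length σ ≡ suc (suc k)) (occ : isOcc σ τ (qc 0 j k) ≡ true)
  (only : ∀ P → isOcc σ τ P ≡ true → P ≡ qc 0 j k)
  (1<j : 1 < j) (room : suc (j + k) < length τ) where

  n : ℕ
  n = length τ

  -- window a b: position 0 and the consecutive positions j-a, …, j+k+b,
  -- i.e. the occurrence of σ widened by a positions to the left and b to
  -- the right; ρ a b is the permutation τ shows there
  window : ℕ → ℕ → List ℕ
  window a b = qc 0 (j ∸ a) (a + k + b)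

  ρ : ℕ → ℕ → List ℕ
  ρ a b = std (τ at window a b)

  ρ′ : ℕ × ℕ → List ℕ
  ρ′ (a , b) = ρ a b

  Fits : ℕ → ℕ → Set
  Fits a b = a < j × j + k + b < n

  Fits-shrink : ∀ {a b a′ b′} → Fits a b → a′ ≤ a → b′ ≤ b → Fits a′ b′
  Fits-shrink (a<j , end<n) a′≤a b′≤b = ≤-<-trans a′≤a a<j , ≤-<-trans (+-monoʳ-≤ (j + k) b′≤b) end<n

  j∸a+a : ∀ {a} → a < j → j ∸ a + a ≡ j
  j∸a+a a<j = m∸n+n≡m (<⇒≤ a<j)

  window-end : ∀ {a} b → a < j → j ∸ a + (a + k + b) ≡ j + k + b
  window-end {a} b a<j = trans (sym (+-assoc (j ∸ a) (a + k) b))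
    (cong (_+ b) (trans (sym (+-assoc (j ∸ a) a k)) (cong (_+ k) (j∸a+a a<j))))

  InBounds-window : ∀ {a b} → Fits a b → InBounds n (window a b)
  InBounds-window {a} {b} (a<j , end<n) =
    InBounds-qc (≤-<-trans z≤n room) (subst (_< n) (sym (window-end b a<j)) end<n)

  length-ρ : ∀ a b → length (ρ a b) ≡ suc (suc (a + k + b))
  length-ρ a b = trans (length-std (τ at window a b)) (trans (length-at τ (window a b)) (length-qc 0 (j ∸ a) (a + k + b)))

  ρ-perm : ∀ {a b} → Fits a b → IsPerm (ρ a b)
  ρ-perm {a} {b} fits@(a<j , _) =
    std-IsPerm (τ at window a b)
      (Unique-at τ (window a b) (Unique-IsPerm τ τ-perm) (Unique-qc 0 (j ∸ a) (a + k + b) (m<n⇒0<n∸m a<j))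
                 (InBounds-window fits))

  ρ-from-≅ : ∀ {z a b} → IsPerm z → z ≅ (τ at window a b) → z ≡ ρ a b
  ρ-from-≅ {z} z-perm iso = trans (sym (IsPerm⇒std≡ z z-perm)) (≅⇒std≡ iso)

  2≤σ : 2 ≤ length σ
  2≤σ = ≤-trans (s≤s (s≤s z≤n)) (≤-reflexive (sym len-σ))

  σ-occurrence : Occurrence σ τ (qc 0 j k)
  σ-occurrence = isOcc-sound σ τ _ 2≤σ occ

  ρ-bottom : ρ 0 0 ≡ σ
  ρ-bottom = sym (ρ-from-≅ {a = 0} {b = 0} σ-perm
    (subst (λ l → σ ≅ (τ at qc 0 j l)) (sym (+-identityʳ k)) (Occurrence.iso σ-occurrence)))

  -- the top of the interval: the widest window, which is all of τ
  A B : ℕ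
  A = j ∸ 1
  B = n ∸ suc (j + k)

  end-top : suc (j + k + B) ≡ n
  end-top = m+[n∸m]≡n (<⇒≤ room)

  fits-top : Fits A B
  fits-top = pred< 1<j , ≤-reflexive end-top
    where
    pred< : ∀ {m} → 1 < m → m ∸ 1 < m
    pred< {suc m} _ = ≤-refl

  j∸A : j ∸ A ≡ 1
  j∸A = m∸[m∸n]≡n (<⇒≤ 1<j)

  size-top : suc (suc (A + k + B)) ≡ n
  size-top = trans (cong suc (trans (cong (_+ (A + k + B)) (sym j∸A)) (window-end B (proj₁ fits-top)))) end-top

  ρ-top : ρ A B ≡ τ
  ρ-top = begin
    std (τ at qc 0 (j ∸ A) (A + k + B))              ≡⟨ cong (λ i → std (τ at qc 0 i (A + k + B))) j∸A ⟩
    std (τ at upTo (suc (suc (A + k + B))))          ≡⟨ cong (λ m → std (τ at upTo m)) size-top ⟩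
    std (τ at upTo n)                                ≡⟨ cong std (at-upTo τ) ⟩
    std τ                                            ≡⟨ IsPerm⇒std≡ τ τ-perm ⟩
    τ                                                ∎
    where open ≡-Reasoning

  -- window a′ b′ read inside window a b, for a′ ≤ a and b′ ≤ b
  inner : ℕ → ℕ → ℕ → List ℕ
  inner a a′ b′ = qc 0 (suc (a ∸ a′)) (a′ + k + b′)

  inner-end : ∀ {a a′} b′ → a′ ≤ a → (a ∸ a′) + (a′ + k + b′) ≡ a + k + b′
  inner-end {a} {a′} b′ a′≤a =
    trans (sym (+-assoc (a ∸ a′) (a′ + k) b′))
      (cong (_+ b′) (trans (sym (+-assoc (a ∸ a′) a′ k)) (cong (_+ k) (m∸n+n≡m a′≤a))))

  window-inner : ∀ {a b a′ b′} → a < j → a′ ≤ a → b′ ≤ b → window a b at inner a a′ b′ ≡ window a′ b′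
  window-inner {a} {b} {a′} {b′} a<j a′≤a b′≤b =
    trans (qc-compose 0 (j ∸ a) (a + k + b) 0 (a ∸ a′) (a′ + k + b′)
            (subst (_≤ a + k + b) (sym (inner-end b′ a′≤a)) (+-monoʳ-≤ (a + k) b′≤b)))
          (cong (λ i → qc 0 i (a′ + k + b′)) start)
    where
    start : j ∸ a + (a ∸ a′) ≡ j ∸ a′
    start = sym (trans (cong (_∸ a′) (sym (trans (+-assoc (j ∸ a) (a ∸ a′) a′)
      (trans (cong (j ∸ a +_) (m∸n+n≡m a′≤a)) (j∸a+a a<j))))) (m+n∸n≡m _ a′))

  inner-occurrence : ∀ {a b a′ b′} → Fits a b → a′ ≤ a → b′ ≤ b →
    InBounds (length (ρ a b)) (inner a a′ b′) × ρ a′ b′ ≅ (ρ a b at inner a a′ b′)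
  inner-occurrence {a} {b} {a′} {b′} fits a′≤a b′≤b = inside , iso
    where
    inside : InBounds (length (ρ a b)) (inner a a′ b′)
    inside = subst (λ m → InBounds m (inner a a′ b′)) (sym (length-ρ a b))
      (InBounds-qc z<s (s≤s (s≤s (subst (_≤ a + k + b) (sym (inner-end b′ a′≤a)) (+-monoʳ-≤ (a + k) b′≤b)))))
    iso : ρ a′ b′ ≅ (ρ a b at inner a a′ b′)
    iso = ≅-trans (std-≅ (τ at window a′ b′)) (≅-sym
            (subst (λ L → (ρ a b at inner a a′ b′) ≅ (τ at L)) (window-inner (proj₁ fits) a′≤a b′≤b)
              (≅-compose {ρ a b} {τ} (window a b) (inner a a′ b′) (std-≅ (τ at window a b)) inside)))

  ρ-monotone : ∀ {a b a′ b′} → Fits a b → a′ ≤ a → b′ ≤ b → leqᵇ (ρ a′ b′) (ρ a b) ≡ true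
  ρ-monotone {a} {b} {a′} {b′} fits a′≤a b′≤b =
    leqᵇ-complete (ρ a′ b′) (ρ a b) 0 (suc (a ∸ a′)) (a′ + k + b′) (length-ρ a′ b′) z<s
      (proj₁ (inner-occurrence fits a′≤a b′≤b)) (proj₂ (inner-occurrence fits a′≤a b′≤b))

  σ≤ρ : ∀ {a b} → Fits a b → leqᵇ σ (ρ a b) ≡ true
  σ≤ρ {a} {b} fits = subst (λ x → leqᵇ x (ρ a b) ≡ true) ρ-bottom (ρ-monotone fits z≤n z≤n)

  pinned : ∀ {i i′} → i < i′ → InBounds n (qc i i′ k) → σ ≅ (τ at qc i i′ k) → i ≡ 0 × i′ ≡ j
  pinned {i} {i′} i<i′ inside iso =
    let e = only (qc i i′ k) (isOcc-complete σ τ i i′ k len-σ i<i′ inside iso)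
    in cong (λ L → nth L 0) e , cong (λ L → nth L 1) e

  -- If z looks like τ on Q = qc i₀ j₀ l and σ occurs in z at qc i (1+t) k,
  -- then reading Q there is an occurrence of σ in τ, hence the given one;
  -- this pins Q down as the window (t , l ∸ (t + k)).
  decode : ∀ {z i₀ j₀ l i t} → i₀ < j₀ → InBounds n (qc i₀ j₀ l) → z ≅ (τ at qc i₀ j₀ l) →
    i ≤ t → InBounds (length z) (qc i (suc t) k) → σ ≅ (z at qc i (suc t) k) →
    j₀ + t ≡ j × qc i₀ j₀ l ≡ window t (l ∸ (t + k))
  decode {z} {i₀} {j₀} {l} {i} {t} i₀<j₀ inQ z≅ i≤t inP σ≅ = proj₂ pin , (begin
    qc i₀ j₀ l                    ≡⟨ cong (λ x → qc x j₀ l) (first-is-0 i i≤t (proj₁ pin)) ⟩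
    qc 0 j₀ l                     ≡⟨ cong₂ (qc 0) (sym (trans (cong (_∸ t) (sym (proj₂ pin))) (m+n∸n≡m j₀ t)))
                                                  (sym (m+[n∸m]≡n t+k≤l)) ⟩
    window t (l ∸ (t + k))        ∎)
    where
    open ≡-Reasoning
    Q : List ℕ
    Q = qc i₀ j₀ l
    len-z : length z ≡ length Q
    len-z = trans (proj₁ z≅) (length-at τ Q)
    t+k≤l : t + k ≤ l
    t+k≤l = s≤s⁻¹ (s≤s⁻¹ (subst (suc t + k <_) (trans len-z (length-qc i₀ j₀ l)) (inP (last-∈-qc i (suc t) k))))
    t≤l : t ≤ l
    t≤l = ≤-trans (m≤m+n t k) t+k≤l
    R≡ : Q at qc i (suc t) k ≡ qc (nth Q i) (j₀ + t) k
    R≡ = qc-compose i₀ j₀ l i t k t+k≤l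
    σ≅R : σ ≅ (τ at qc (nth Q i) (j₀ + t) k)
    σ≅R = subst (λ L → σ ≅ (τ at L)) R≡ (≅-trans {σ} σ≅ (≅-compose {z} {τ} Q (qc i (suc t) k) z≅ inP))
    inR : InBounds n (qc (nth Q i) (j₀ + t) k)
    inR = subst (InBounds n) R≡
            (InBounds-at n Q (qc i (suc t) k) inQ (subst (λ m → InBounds m (qc i (suc t) k)) len-z inP))
    R-increasing : nth Q i < j₀ + t
    R-increasing = subst (nth Q i <_) (nth-qc i₀ j₀ l t t≤l)
                     (qc-increasing i₀ j₀ l i (suc t) i₀<j₀ (s≤s i≤t) (s≤s t≤l))
    pin : nth Q i ≡ 0 × j₀ + t ≡ j
    pin = pinned R-increasing inR σ≅R
    -- position 0 is only reachable through the first entry of Q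
    first-is-0 : ∀ i → i ≤ t → nth Q i ≡ 0 → i₀ ≡ 0
    first-is-0 zero _ e = e
    first-is-0 (suc s) s<t e =
      let j₀+s≡0 = trans (sym (nth-qc i₀ j₀ l s (≤-trans (<⇒≤ s<t) t≤l))) e
      in ⊥-elim (n≮0 (subst (i₀ <_) (m+n≡0⇒m≡0 j₀ j₀+s≡0) i₀<j₀))

  window-occurrence : ∀ {z a b i t l} → Fits a b → i ≤ t → InBounds (length (ρ a b)) (qc i (suc t) l) →
    z ≅ (ρ a b at qc i (suc t) l) →
    t + l ≤ a + k + b × nth (window a b) i < j ∸ a + t ×
    InBounds n (qc (nth (window a b) i) (j ∸ a + t) l) × z ≅ (τ at qc (nth (window a b) i) (j ∸ a + t) l)
  window-occurrence {z} {a} {b} {i} {t} {l} fits@(a<j , _) i≤t inP z≅ =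
    t+l≤ , increasing ,
    subst (InBounds n) Q≡ (InBounds-at n (window a b) P (InBounds-window fits) inP′) ,
    subst (λ L → z ≅ (τ at L)) Q≡
      (≅-trans {z} z≅ (≅-compose {ρ a b} {τ} (window a b) P (std-≅ (τ at window a b)) inP))
    where
    P : List ℕ
    P = qc i (suc t) l
    inP′ : InBounds (length (window a b)) P
    inP′ = subst (λ m → InBounds m P) (trans (length-ρ a b) (sym (length-qc 0 (j ∸ a) (a + k + b)))) inP
    t+l≤ : t + l ≤ a + k + b
    t+l≤ = s≤s⁻¹ (s≤s⁻¹ (subst (suc t + l <_) (length-ρ a b) (inP (last-∈-qc i (suc t) l))))
    t≤ : t ≤ a + k + b
    t≤ = ≤-trans (m≤m+n t l) t+l≤
    Q≡ : window a b at P ≡ qc (nth (window a b) i) (j ∸ a + t) l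
    Q≡ = qc-compose 0 (j ∸ a) (a + k + b) i t l t+l≤
    increasing : nth (window a b) i < j ∸ a + t
    increasing = subst (nth (window a b) i <_) (nth-qc 0 (j ∸ a) (a + k + b) t t≤)
      (qc-increasing 0 (j ∸ a) (a + k + b) i (suc t) (m<n⇒0<n∸m a<j) (s≤s i≤t) (s≤s t≤))

  narrower : ∀ {a b t₁ t₂ l b′} → a < j → j ∸ a + t₂ + t₁ ≡ j → t₂ + l ≤ a + k + b → l ≡ t₁ + k + b′ →
    t₁ ≤ a × b′ ≤ b
  narrower {a} {b} {t₁} {t₂} {l} {b′} a<j at-j inside l≡ = t₁≤a , b′≤b
    where
    t₂+t₁≡a : t₂ + t₁ ≡ a
    t₂+t₁≡a = +-cancelˡ-≡ (j ∸ a) (t₂ + t₁) a (trans (sym (+-assoc (j ∸ a) t₂ t₁)) (trans at-j (sym (j∸a+a a<j))))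
    t₁≤a : t₁ ≤ a
    t₁≤a = subst (t₁ ≤_) t₂+t₁≡a (m≤n+m t₁ t₂)
    b′≤b : b′ ≤ b
    b′≤b = +-cancelˡ-≤ (a + k) b′ b (subst (_≤ a + k + b) spread inside)
      where
      spread : t₂ + l ≡ a + k + b′
      spread = begin
        t₂ + l                    ≡⟨ cong (t₂ +_) l≡ ⟩
        t₂ + (t₁ + k + b′)        ≡⟨ sym (+-assoc t₂ (t₁ + k) b′) ⟩
        t₂ + (t₁ + k) + b′        ≡⟨ cong (_+ b′) (sym (+-assoc t₂ t₁ k)) ⟩
        t₂ + t₁ + k + b′          ≡⟨ cong (λ x → x + k + b′) t₂+t₁≡a ⟩
        a + k + b′                ∎
        where open ≡-Reasoning

  -- every permutation z with σ ≤ z < ρ a b is the ρ of a smaller window: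
  -- read the occurrence of σ in z through the occurrence of z in ρ a b
  interval-element : ∀ {a b z P₁ P₂} → Fits a b → IsPerm z → length z < length (ρ a b) →
    Occurrence σ z P₁ → Occurrence z (ρ a b) P₂ → z ∈ map ρ′ (box a b without (a , b))
  interval-element {a} {b} {z} {P₁} fits z-perm shorter occ₁ occ₂ =
    subst (_∈ map ρ′ (box a b without (a , b))) (sym z≡)
      (∈-map⁺ ρ′ (box-without⁺ a b (proj₁ bounds) (proj₂ bounds) different))
    where
    module O₁ = Occurrence occ₁
    module O₂ = Occurrence occ₂
    t₁ t₂ l b′ : ℕ
    t₁ = O₁.t
    t₂ = O₂.t
    l = length z ∸ 2
    b′ = l ∸ (t₁ + k)
    shape₁ : P₁ ≡ qc O₁.i (suc t₁) k
    shape₁ = trans O₁.shape (cong (λ m → qc O₁.i (suc t₁) (m ∸ 2)) len-σ)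
    Q : List ℕ
    Q = qc (nth (window a b) O₂.i) (j ∸ a + t₂) l
    in-ρ : t₂ + l ≤ a + k + b × nth (window a b) O₂.i < j ∸ a + t₂ × InBounds n Q × z ≅ (τ at Q)
    in-ρ = window-occurrence {z} fits O₂.i≤t
      (subst (InBounds (length (ρ a b))) O₂.shape O₂.inBounds) (subst (λ L → z ≅ (ρ a b at L)) O₂.shape O₂.iso)
    z≅ : z ≅ (τ at Q)
    z≅ = proj₂ (proj₂ (proj₂ in-ρ))
    decoded : j ∸ a + t₂ + t₁ ≡ j × Q ≡ window t₁ b′
    decoded = decode {z} (proj₁ (proj₂ in-ρ)) (proj₁ (proj₂ (proj₂ in-ρ))) z≅ O₁.i≤t
      (subst (InBounds (length z)) shape₁ O₁.inBounds) (subst (λ L → σ ≅ (z at L)) shape₁ O₁.iso)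
    z≡ : z ≡ ρ t₁ b′
    z≡ = ρ-from-≅ {a = t₁} {b = b′} z-perm (subst (λ L → z ≅ (τ at L)) (proj₂ decoded) z≅)
    l≡ : l ≡ t₁ + k + b′
    l≡ = suc-injective (suc-injective (trans (sym (length-qc (nth (window a b) O₂.i) (j ∸ a + t₂) l))
      (trans (cong length (proj₂ decoded)) (length-qc 0 (j ∸ t₁) (t₁ + k + b′)))))
    bounds : t₁ ≤ a × b′ ≤ b
    bounds = narrower (proj₁ fits) (proj₁ decoded) (proj₁ in-ρ) l≡
    different : (t₁ , b′) ≢ (a , b)
    different refl = <-irrefl (cong length z≡) shorter

  -- distinct windows give distinct permutations: σ sits a positions into
  -- ρ a b, and decoding that occurrence inside ρ a′ b′ recovers a
  ρ-injective : ∀ {a b a′ b′} → Fits a b → Fits a′ b′ → ρ a b ≡ ρ a′ b′ → a ≡ a′ × b ≡ b′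
  ρ-injective {a} {b} {a′} {b′} fits fits′@(a′<j , _) e = a≡a′ , b≡b′
    where
    σ-inside : InBounds (length (ρ a b)) (inner a 0 0) × ρ 0 0 ≅ (ρ a b at inner a 0 0)
    σ-inside = inner-occurrence fits (z≤n {a}) (z≤n {b})
    shape : inner a 0 0 ≡ qc 0 (suc a) k
    shape = cong (qc 0 (suc a)) (+-identityʳ k)
    σ≅ : σ ≅ (ρ a b at qc 0 (suc a) k)
    σ≅ = subst₂ (λ x L → x ≅ (ρ a b at L)) ρ-bottom shape (proj₂ σ-inside)
    looks : ρ a b ≅ (τ at window a′ b′)
    looks = subst (_≅ (τ at window a′ b′)) (sym e) (std-≅ (τ at window a′ b′))
    decoded : j ∸ a′ + a ≡ j × window a′ b′ ≡ window a (a′ + k + b′ ∸ (a + k))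
    decoded = decode {ρ a b} (m<n⇒0<n∸m a′<j) (InBounds-window fits′) looks z≤n
      (subst (InBounds (length (ρ a b))) shape (proj₁ σ-inside)) σ≅
    a≡a′ : a ≡ a′
    a≡a′ = +-cancelˡ-≡ (j ∸ a′) a a′ (trans (proj₁ decoded) (sym (j∸a+a a′<j)))
    b≡b′ : b ≡ b′
    b≡b′ = +-cancelˡ-≡ (a + k) b b′ (trans (suc-injective (suc-injective (trans (sym (length-ρ a b))
      (trans (cong length e) (length-ρ a′ b′))))) (cong (λ x → x + k + b′) (sym a≡a′)))

  below-ρ⁻ : ∀ {a b z} → Fits a b → z ∈ below σ (ρ a b) → z ∈ map ρ′ (box a b without (a , b))
  below-ρ⁻ {a} {b} {z} fits z∈ =
    let z-perm , shorter , σ≤z , z≤ρ = ∈-below⁻ σ (ρ a b) z∈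
        P₁ , found₁ = leqᵇ-sound σ z σ≤z
        P₂ , found₂ = leqᵇ-sound z (ρ a b) z≤ρ
        occ₁ = isOcc-sound σ z P₁ 2≤σ found₁
    in interval-element fits z-perm shorter occ₁ (isOcc-sound z (ρ a b) P₂ (Occurrence-host occ₁) found₂)

  below-ρ⁺ : ∀ {a b x} → Fits a b → x ∈ map ρ′ (box a b without (a , b)) → x ∈ below σ (ρ a b)
  below-ρ⁺ {a} {b} {x} fits x∈ =
    let (a′ , b′) , p∈ , x≡ = ∈-map⁻ ρ′ x∈
        a′≤a , b′≤b , p≢ = box-without⁻ a b p∈
        fits′ = Fits-shrink fits a′≤a b′≤b
        shorter = subst₂ _<_ (sym (length-ρ a′ b′)) (sym (length-ρ a b)) (s≤s (s≤s (box-below-sum k a′≤a b′≤b p≢)))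
    in subst (_∈ below σ (ρ a b)) (sym x≡)
         (∈-below⁺ σ (ρ a b) (ρ-perm fits′) shorter (σ≤ρ fits′) (ρ-monotone fits a′≤a b′≤b))

  sum-below-ρ : ∀ (F : List ℕ → ℤ) {a b} → Fits a b →
    sumℤ (map F (below σ (ρ a b))) ≡ sumℤ (map (F ∘ ρ′) (box a b without (a , b)))
  sum-below-ρ F {a} {b} fits =
    trans (sum-sameMembers F _ _ below! image! (below-ρ⁻ fits) (below-ρ⁺ fits))
          (cong sumℤ (sym (map-∘ (box a b without (a , b)))))
    where
    below! : Unique (below σ (ρ a b))
    below! = UniqueP.filter⁺ (T? ∘ λ y → leqᵇ σ y ∧ leqᵇ y (ρ a b)) (Unique-permsBelow (length (ρ a b)))
    image! : Unique (map ρ′ (box a b without (a , b)))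
    image! = Unique-map ρ′ injective (UniqueP.filter⁺ (other-than (a , b)) (Unique-box a b))
      where
      injective : ∀ {p q} → p ∈ box a b without (a , b) → q ∈ box a b without (a , b) → ρ′ p ≡ ρ′ q → p ≡ q
      injective {a₁ , b₁} {a₂ , b₂} p∈ q∈ e =
        let a₁≤ , b₁≤ , _ = box-without⁻ a b p∈ ; a₂≤ , b₂≤ , _ = box-without⁻ a b q∈
            a≡ , b≡ = ρ-injective (Fits-shrink fits a₁≤ b₁≤) (Fits-shrink fits a₂≤ b₂≤) e
        in cong₂ _,_ a≡ b≡

  μ-bottom : μ σ (ρ 0 0) ≡ productμ (0 , 0)
  μ-bottom = trans (cong (μ σ) ρ-bottom) (μF-refl (length σ) σ)

  μ-ρ : ∀ N {a b} → a + b ≤ N → Fits a b → μ σ (ρ a b) ≡ productμ (a , b)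
  μ-ρ zero {zero} {zero} _ _ = μ-bottom
  μ-ρ (suc N) {a} {b} a+b≤N fits with (a ≟ 0) ×-dec (b ≟ 0)
  ... | yes (refl , refl) = μ-bottom
  ... | no not-bottom = begin
    μF (length (ρ a b)) σ (ρ a b)                               ≡⟨ cong (λ f → μF f σ (ρ a b)) (length-ρ a b) ⟩
    μF (suc (suc K)) σ (ρ a b)                                  ≡⟨ μF-unfold (suc K) σ (ρ a b) σ≢ρ (σ≤ρ fits) ⟩
    - sumℤ (map (μF (suc K) σ) (below σ (ρ a b)))               ≡⟨ cong -_ (sum-below-ρ (μF (suc K) σ) fits) ⟩
    - sumℤ (map (μF (suc K) σ ∘ ρ′) (box a b without (a , b)))
      ≡⟨ cong (λ L → - sumℤ L) (map-cong-∈ _ productμ _ smaller) ⟩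
    - sumℤ (map productμ (box a b without (a , b)))             ≡⟨ productμ-recursion a b not-bottom ⟩
    productμ (a , b)                                            ∎
    where
    open ≡-Reasoning
    K : ℕ
    K = a + k + b
    σ≢ρ : σ ≢ ρ a b
    σ≢ρ e = <-irrefl (suc-injective (suc-injective (trans (sym len-σ) (trans (cong length e) (length-ρ a b)))))
      (subst (_< K) (+-identityʳ k)
        (box-below-sum k z≤n z≤n (λ e → not-bottom (cong proj₁ (sym e) , cong proj₂ (sym e)))))
    smaller : ∀ {p} → p ∈ box a b without (a , b) → μF (suc K) σ (ρ′ p) ≡ productμ p
    smaller {a′ , b′} p∈ =
      let a′≤a , b′≤b , p≢ = box-without⁻ a b p∈
          shorter = box-below-sum k a′≤a b′≤b p≢
          a′+b′<a+b = subst₂ _<_ (cong (_+ b′) (+-identityʳ a′)) (cong (_+ b) (+-identityʳ a))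
                        (box-below-sum 0 a′≤a b′≤b p≢)
      in trans (μF-fuel σ (suc K) (length (ρ a′ b′)) (ρ a′ b′)
                        (subst (_≤ suc K) (sym (length-ρ a′ b′)) (s≤s shorter)) ≤-refl)
               (μ-ρ N (s≤s⁻¹ (≤-trans a′+b′<a+b a+b≤N)) (Fits-shrink fits a′≤a b′≤b))

  μ-σ-τ : μ σ τ ≡ productμ (A , B)
  μ-σ-τ = trans (cong (μ σ) (sym ρ-top)) (μ-ρ (A + B) ≤-refl fits-top)

  rank-σ-τ : length τ ∸ length σ ≡ A + B
  rank-σ-τ = begin
    length τ ∸ length σ          ≡⟨ cong₂ _∸_ (sym size-top) len-σ ⟩
    (A + k + B) ∸ k              ≡⟨ cong (_∸ k) (trans (+-assoc A k B)
                                      (trans (cong (A +_) (+-comm k B)) (sym (+-assoc A B k)))) ⟩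
    (A + B + k) ∸ k              ≡⟨ m+n∸n≡m (A + B) k ⟩
    A + B                        ∎
    where open ≡-Reasoning

  -- both chains are nontrivial: position 1 is skipped and position n-1 is free
  1≤A : 1 ≤ A
  1≤A = m<n⇒0<n∸m 1<j

  1≤B : 1 ≤ B
  1≤B = m<n⇒0<n∸m room


productμ-top : ∀ a b → 1 ≤ a → 1 ≤ b →
  (a + b ≡ 2 → productμ (a , b) ≡ ℤ.pos 1) × (a + b ≢ 2 → productμ (a , b) ≡ ℤ.pos 0)
productμ-top (suc zero) (suc zero) _ _ = (λ _ → refl) , (λ r≢2 → ⊥-elim (r≢2 refl))
productμ-top (suc zero) (suc (suc b)) _ _ = (λ ()) , (λ _ → refl)
productμ-top (suc (suc a)) (suc b) _ _ =
  (λ r≡2 → ⊥-elim (1+n≢0 (trans (sym (+-suc a b)) (suc-injective (suc-injective r≡2))))) , (λ _ → refl)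

singleton-occurrence : ∀ σ τ p → length σ ≡ 1 → p < length τ → isOcc σ τ (p ∷ []) ≡ true
singleton-occurrence σ τ p len p< =
  ∧-intro (≡ᵇ-complete (sym len))
    (∧-intro refl (∧-intro (∧-intro (<ᵇ-complete p<) refl) (orderIso-complete σ _ (len , same))))
  where
  same : ∀ s t → s < length σ → t < length σ → (nth σ s <ᵇ nth σ t) ≡ (nth (nth τ p ∷ []) s <ᵇ nth (nth τ p ∷ []) t)
  same zero zero _ _ = trans (≥⇒<ᵇ-false (≤-refl {nth σ 0})) (sym (≥⇒<ᵇ-false (≤-refl {nth τ p})))
  same (suc s) _ s< _ with () ← s≤s⁻¹ (subst (suc s <_) len s<)
  same zero (suc t) _ t< with () ← s≤s⁻¹ (subst (suc t <_) len t<)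

m∸1≢0⇒1<m : ∀ {m} → 0 < m → m ∸ 1 ≢ 0 → 1 < m
m∸1≢0⇒1<m {suc zero} _ m∸1≢0 = ⊥-elim (m∸1≢0 refl)
m∸1≢0⇒1<m {suc (suc m)} _ _ = s≤s (s≤s z≤n)

-- Under the hypotheses of the theorem σ has at least two entries: a lone
-- entry at position 0 would occur again at position 1.
pattern-length : ∀ σ τ occ → isOcc σ τ occ ≡ true → (∀ P → isOcc σ τ P ≡ true → P ≡ occ) →
  0 ∈ occ → (length τ ∸ 1) ∉ occ → 2 ≤ length σ
pattern-length σ τ [] _ _ () _
pattern-length σ τ occ@(_ ∷ _ ∷ _) found _ _ _ = subst (2 ≤_) (proj₁ (isOcc-basic σ τ occ found)) (s≤s (s≤s z≤n))
pattern-length σ τ (0 ∷ []) found only (here refl) last∉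
  with () ← only (1 ∷ []) (singleton-occurrence σ τ 1 (sym (proj₁ (isOcc-basic σ τ (0 ∷ []) found)))
                            (m∸1≢0⇒1<m (proj₂ (isOcc-basic σ τ (0 ∷ []) found) (here refl)) (last∉ ∘ here)))

occurrence-shape : ∀ σ τ occ k → length σ ≡ suc (suc k) → isOcc σ τ occ ≡ true →
  0 ∈ occ → 1 ∉ occ → (length τ ∸ 1) ∉ occ → ∃[ j ] occ ≡ qc 0 j k × 1 < j × suc (j + k) < length τ
occurrence-shape σ τ occ k len-σ found 0∈ 1∉ last∉ = suc t , shape₀ , 1<j , room
  where
  occ₀ : Occurrence σ τ occ
  occ₀ = isOcc-sound σ τ occ (subst (2 ≤_) (sym len-σ) (s≤s (s≤s z≤n))) found
  open Occurrence occ₀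
  shape′ : occ ≡ qc i (suc t) k
  shape′ = trans shape (cong (λ m → qc i (suc t) (m ∸ 2)) len-σ)
  i≡0 : i ≡ 0
  i≡0 with ∈-qc (subst (0 ∈_) shape′ 0∈)
  ... | inj₁ 0≡i = sym 0≡i
  ... | inj₂ (_ , _ , ())
  shape₀ : occ ≡ qc 0 (suc t) k
  shape₀ = trans shape′ (cong (λ x → qc x (suc t) k) i≡0)
  1<j : 1 < suc t
  1<j = s≤s (n≢0⇒n>0 (λ t≡0 → 1∉ (subst (1 ∈_) (sym shape₀) (there (here (cong suc (sym t≡0)))))))
  last∈occ : suc t + k ∈ occ
  last∈occ = subst (suc t + k ∈_) (sym shape′) (last-∈-qc i (suc t) k)
  room : suc (suc t + k) < length τ
  room with m≤n⇒m<n∨m≡n (inBounds last∈occ)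
  ... | inj₁ beyond = beyond
  ... | inj₂ at-end = ⊥-elim (last∉ (subst (_∈ occ) (cong (_∸ 1) at-end) last∈occ))

proposition4p3 : (σ τ : List ℕ) → IsPerm σ → IsPerm τ →
    (occ : List ℕ) → isOcc σ τ occ ≡ true →
    ((js : List ℕ) → isOcc σ τ js ≡ true → js ≡ occ) →
    0 ∈ occ → 1 ∉ occ → (length τ ∸ 1) ∉ occ →
    ((length τ ∸ length σ ≡ 2 → μ σ τ ≡ ℤ.pos 1) ×
     (length τ ∸ length σ ≢ 2 → μ σ τ ≡ ℤ.pos 0))
proposition4p3 σ τ σ-perm τ-perm occ found only 0∈ 1∉ last∉ =
  (λ rank≡2 → trans μ-σ-τ (proj₁ values (trans (sym rank-σ-τ) rank≡2))) ,
  (λ rank≢2 → trans μ-σ-τ (proj₂ values (rank≢2 ∘ trans rank-σ-τ)))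
  where
  k : ℕ
  k = length σ ∸ 2
  len-σ : length σ ≡ suc (suc k)
  len-σ = sym (m+[n∸m]≡n (pattern-length σ τ occ found only 0∈ last∉))
  shape : ∃[ j ] occ ≡ qc 0 j k × 1 < j × suc (j + k) < length τ
  shape = occurrence-shape σ τ occ k len-σ found 0∈ 1∉ last∉
  j : ℕ
  j = proj₁ shape
  occ≡ : occ ≡ qc 0 j k
  occ≡ = proj₁ (proj₂ shape)
  open Interval σ τ σ-perm τ-perm k j len-σ (subst (λ P → isOcc σ τ P ≡ true) occ≡ found)
         (λ P found′ → trans (only P found′) occ≡) (proj₁ (proj₂ (proj₂ shape))) (proj₂ (proj₂ (proj₂ shape)))
  values : (A + B ≡ 2 → productμ (A , B) ≡ ℤ.pos 1) × (A + B ≢ 2 → productμ (A , B) ≡ ℤ.pos 0)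
  values = productμ-top A B 1≤A 1≤B
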